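{- Let $m\ge 2$, $n=2m$, $q=2^m$, let $\omega$ be a primitive element of $\mathbb{F}_{q^2}$ and $u=\omega^{(q-1)(2^{n-1}-1)}$ (a generator of $\mu_{q+1}$). Let $a_1\in\mathbb{F}_{q^2}$, $a_2\in\mathbb{F}_{q^2}^*$, let $l_1,l_2$ be non-negative integers with $\gcd(l_2,q+1)=1$, let $I\subseteq\mathbb{Z}_q=\{0,\dots,q-1\}$ and $N=\bigcup_{i\in I}u^i\mathbb{F}_q^*$. Define $$f(x)=\begin{cases}{\rm Tr}_1^n(a_1x^{l_1(q-1)}), & x\in N,\\ {\rm Tr}_1^n(a_2x^{l_2(q-1)}), & \text{otherwise}.\end{cases}$$ Then $f$ is bent if and only if $$\sum_{i\in I}\Big((-1)^{{\rm Tr}_1^n(a_1u^{ -2il_1})}-(-1)^{{\rm Tr}_1^n(a_2u^{ -2il_2})}\Big)=K_m(a_2^{q+1}).$$ Moreover, in that case the dual of $f$ is $$\widetilde f(x)=\begin{cases}{\rm Tr}_1^n(a_1x^{l_1(1-q)}), & x^{q-1}=u^{2i}\text{ for some } i\in I,\\ {\rm Tr}_1^n(a_2x^{l_2(1-q)}), & \text{otherwise},\end{cases}$$ where $x^{l(1-q)}$ denotes $x^{l(q^2-q)}$.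
   Context: ${\rm Tr}_1^k$ is the absolute trace of $\mathbb{F}_{2^k}$, $\mu_e=\{x:x^e=1\}$. $K_m(a)=\sum_{x\in\mathbb{F}_{q}}(-1)^{{\rm Tr}_1^m(ax+x^{q-2})}$ is the Kloosterman sum over $\mathbb{F}_q$. Walsh transform $\widehat f(b)=\sum_x(-1)^{f(x)+{\rm Tr}_1^n(bx)}$; $f$ bent iff $|\widehat f(b)|=2^{n/2}$ for all $b$; dual $\widetilde f$ defined by $\widehat f(b)=2^{n/2}(-1)^{\widetilde f(b)}$. -}

module Defs where

open import Level using (0ℓ)
open import Data.Nat as ℕ using (ℕ; zero; suc)
open import Data.Bool using (Bool; true; false; not; _xor_; if_then_else_)
open import Data.Integer as ℤ using (ℤ; +_; -[1+_])
open import Data.List using (List; []; _∷_; map; filter; length; foldr)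
open import Data.List.Membership.Propositional using (_∈_)
open import Data.List.Relation.Unary.Unique.Propositional using (Unique)
open import Data.Fin as Fin using (Fin; toℕ)
open import Data.Fin.Subset using (Subset)
open import Data.Vec using (lookup)
open import Data.Product using (Σ; ∃; _×_; _,_)
open import Relation.Nullary using (¬_; does)
open import Relation.Binary.PropositionalEquality using (_≡_; _≢_)
open import Relation.Binary.Definitions using (DecidableEquality)
open import Algebra.Structures using (IsCommutativeRing)

record GF2^ (k : ℕ) : Set₁ where
  infixl 6 _+_
  infixl 7 _*_
  field
    F     : Set
    _+_   : F → F → F
    _*_   : F → F → F
    -_    : F → F
    0#    : F
    1#    : F
    _⁻¹   : F → F
    isCommutativeRing : IsCommutativeRing _≡_ _+_ _*_ -_ 0# 1#
    0≢1   : 0# ≢ 1#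
    inverseʳ : ∀ x → x ≢ 0# → x * (x ⁻¹) ≡ 1#
    inv-0 : 0# ⁻¹ ≡ 0#
    char2 : 1# + 1# ≡ 0#
    _≟_   : DecidableEquality F
    elems : List F
    complete : ∀ x → x ∈ elems
    unique : Unique elems
    size  : length elems ≡ 2 ℕ.^ k

  _^_ : F → ℕ → F
  x ^ zero  = 1#
  x ^ suc e = x * (x ^ e)

  trace : ℕ → F → F
  trace zero    y = 0#
  trace (suc r) y = (y ^ (2 ℕ.^ r)) + trace r y

  -- a field element in F_2 ⊆ F seen as a bit: false ↔ 0, true ↔ 1
  bit : F → Bool
  bit y = not (does (y ≟ 0#))

  Tr : F → Bool
  Tr y = bit (trace k y)

  subfieldElems : ℕ → List F
  subfieldElems r = filter (λ x → (x ^ (2 ℕ.^ r)) ≟ x) elems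

  IsPrimitive : F → Set
  IsPrimitive ω = ∀ x → x ≢ 0# → ∃ λ e → ω ^ e ≡ x

sgn : Bool → ℤ
sgn false = + 1
sgn true  = -[1+ 0 ]

sumℤ : List ℤ → ℤ
sumℤ = foldr ℤ._+_ (+ 0)

sumFin : ∀ {n} → (Fin n → ℤ) → ℤ
sumFin {zero}  g = + 0
sumFin {suc n} g = g Fin.zero ℤ.+ sumFin (λ i → g (Fin.suc i))

sumSubset : ∀ {n} → Subset n → (Fin n → ℤ) → ℤ
sumSubset I g = sumFin (λ i → if lookup I i then g i else + 0)

module _ {k : ℕ} (𝔽 : GF2^ k) where
  open GF2^ 𝔽

  walsh : (F → Bool) → F → ℤ
  walsh f b = sumℤ (map (λ x → sgn (f x xor Tr (b * x))) elems)

  IsBent : ℕ → (F → Bool) → Set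
  IsBent h f = ∀ b → ℤ.∣ walsh f b ∣ ≡ 2 ℕ.^ h

  IsDualOf : ℕ → (F → Bool) → (F → Bool) → Set
  IsDualOf h g f = ∀ b → walsh f b ≡ (+ (2 ℕ.^ h)) ℤ.* sgn (g b)

  kloosterman : ℕ → F → ℤ
  kloosterman m a =
    sumℤ (map (λ x → sgn (bit (trace m ((a * x) + (x ^ ((2 ℕ.^ m) ℕ.∸ 2))))))
              (subfieldElems m))

-- Since f depends only on x^(q-1), which ranges over μ_(q+1) = ⟨v⟩ with v = ω^(q-1) = u⁻², we have f 0 = 0
-- and f x = φ (x^(q-1)) otherwise, for a Boolean function φ on μ_(q+1). The Walsh transform W is invariant
-- under b ↦ β b for β ∈ F_q^*; averaging over these rotations and using orthogonality of the characters of F_q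
-- gives (q - 1) W(b) = q Z(b) - W(0), where Z(b) only sees the line b⁻¹ F_q. Hence f is bent iff W(0) = q
-- (the value -q is excluded as W(0) ≡ 1 mod q - 1), and then W(b) = q (-1)^f(b⁻¹), which is the stated dual.
-- Counting by cosets, W(0) = 1 + (q - 1) Σ_(z ∈ μ_(q+1)) (-1)^φ(z), so f is bent iff this sum is 1. Splitting
-- it along I and substituting z ↦ z^l₂ (a permutation of μ_(q+1), as gcd(l₂, q + 1) = 1) leaves
-- Σ_(z ∈ μ_(q+1)) (-1)^Tr(a₂ z), which is 1 - K_m(a₂^(q+1)): detect z^(q+1) = 1 by the characters of F_q, and
-- evaluate the resulting sums by completing the norm y^(q+1).
module Submission where

open import Defs
open import Algebra.Bundles using (CommutativeRing)
open import Algebra.Structures using (IsCommutativeRing)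
open import Tactic.RingSolver.Core.AlmostCommutativeRing using (fromCommutativeRing)
open import Data.Bool using (Bool; true; false; if_then_else_; _xor_)
open import Data.Bool.Properties using (xor-identityʳ)
open import Data.Empty using (⊥-elim)
open import Data.Fin as Fin using (Fin; toℕ)
import Data.Fin.Properties as Finₚ
open import Data.Fin.Subset using (Subset; _∈_)
open import Data.Fin.Subset.Properties using (_∈?_)
open import Data.Integer as ℤ using (ℤ)
import Data.Integer.Properties as ℤP
import Data.Integer.Solver as ℤ-Solver
open import Data.List using (List; []; _∷_; map; length; foldr; filter; applyUpTo)
open import Data.List.Properties using (length-applyUpTo; length-removeAt′; length-map)
open import Data.List.Membership.Propositional using (find; lose) renaming (_∈_ to _∈ₗ_)
open import Data.List.Membership.Propositional.Properties using (∈-applyUpTo⁺; ∈-applyUpTo⁻; ∈-filter⁺; ∈-filter⁻; ∈-map⁺)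
open import Data.List.Relation.Binary.Subset.Propositional using (_⊆_)
import Data.List.Relation.Unary.All as All
open import Data.List.Relation.Unary.AllPairs using ([]; _∷_)
open import Data.List.Relation.Unary.Any using (here; there; _─_; any?)
open import Data.List.Relation.Unary.Unique.Propositional using (Unique)
import Data.List.Relation.Unary.Unique.Propositional.Properties as Unique
open import Data.Maybe using (nothing)
open import Data.Nat as ℕ using (ℕ; zero; suc; _≤_; _<_; z≤n; s≤s)
import Data.Nat.Properties as ℕP
open import Data.Nat.Coprimality as Coprime using (Coprime; gcd≡1⇒coprime; coprime-divisor)
open import Data.Nat.Divisibility using (_∣_; m%n≡0⇒n∣m; ∣⇒≤; *-cancelˡ-∣)
open import Data.Nat.DivMod using (_%_; _/_; m≡m%n+[m/n]*n; m%n<n)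
open import Data.Nat.GCD using (gcd; gcd-identityˡ)
import Data.Nat.Solver as ℕ-Solver
open import Data.Product using (∃; Σ; _×_; _,_; proj₁; proj₂)
open import Data.Sum using (_⊎_; inj₁; inj₂)
open import Data.Vec using (lookup)
open import Data.Vec.Properties using ([]=⇒lookup; lookup⇒[]=)
open import Function using (case_of_)
open import Function.Bundles using (_⇔_; mk⇔; Equivalence)
import Function.Properties.Equivalence as ⇔
open import Relation.Binary.Definitions using (tri<; tri≈; tri>)
open import Relation.Binary.PropositionalEquality
open import Relation.Nullary using (¬_; Dec; yes; no; does; ¬?)
open import Relation.Nullary.Decidable using (dec-true; dec-false; _×-dec_)
open import Relation.Unary using (Pred; Decidable)

open ≡-Reasoning

private variable A B : Set

∈-─ : ∀ {x z : A} {ys : List A} (p : x ∈ₗ ys) → z ∈ₗ ys → z ≢ x → z ∈ₗ (ys ─ p)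
∈-─ (here refl) (here refl) z≢x = ⊥-elim (z≢x refl)
∈-─ (here refl) (there z∈ys) _ = z∈ys
∈-─ (there p) (here refl) _ = here refl
∈-─ (there p) (there z∈ys) z≢x = there (∈-─ p z∈ys z≢x)

Unique⇒length≤ : ∀ {xs ys : List A} → Unique xs → xs ⊆ ys → length xs ≤ length ys
Unique⇒length≤ {xs = []} _ _ = z≤n
Unique⇒length≤ {xs = x ∷ xs} {ys} (x∉xs ∷ u) sub =
  subst (suc (length xs) ≤_) (sym (length-removeAt′ ys _))
    (s≤s (Unique⇒length≤ u λ z∈xs → ∈-─ p (sub (there z∈xs)) (λ { refl → All.lookup x∉xs z∈xs refl })))
  where
  p : x ∈ₗ ys
  p = sub (here refl)

module FoldComm {C : Set} (_∙_ : C → C → C) (ε : C)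
                (assoc : ∀ x y z → (x ∙ y) ∙ z ≡ x ∙ (y ∙ z))
                (comm : ∀ x y → x ∙ y ≡ y ∙ x) where

  fold : List C → C
  fold = foldr _∙_ ε

  fold-─ : ∀ (g : A → C) {x} {ys : List A} (p : x ∈ₗ ys) →
           fold (map g ys) ≡ g x ∙ fold (map g (ys ─ p))
  fold-─ g (here refl) = refl
  fold-─ g {ys = y ∷ ys} (there p) = begin
    g y ∙ fold (map g ys)                   ≡⟨ cong (g y ∙_) (fold-─ g p) ⟩
    g y ∙ (g _ ∙ fold (map g (ys ─ p)))     ≡⟨ sym (assoc _ _ _) ⟩
    (g y ∙ g _) ∙ fold (map g (ys ─ p))     ≡⟨ cong (_∙ fold (map g (ys ─ p))) (comm _ _) ⟩
    (g _ ∙ g y) ∙ fold (map g (ys ─ p))     ≡⟨ assoc _ _ _ ⟩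
    g _ ∙ (g y ∙ fold (map g (ys ─ p)))     ∎

  -- The hypotheses make ys a rearrangement of xs.
  fold-⊆ : ∀ (g : A → C) {xs ys : List A} → Unique xs → xs ⊆ ys →
           length ys ≤ length xs → fold (map g ys) ≡ fold (map g xs)
  fold-⊆ g {[]} {[]} _ _ _ = refl
  fold-⊆ g {x ∷ xs} {ys} (x∉xs ∷ u) sub len = begin
    fold (map g ys)                 ≡⟨ fold-─ g p ⟩
    g x ∙ fold (map g (ys ─ p))     ≡⟨ cong (g x ∙_) (fold-⊆ g u sub′ len′) ⟩
    g x ∙ fold (map g xs)           ∎
    where
    p : x ∈ₗ ys
    p = sub (here refl)
    sub′ : xs ⊆ (ys ─ p)
    sub′ z∈xs = ∈-─ p (sub (there z∈xs)) (λ { refl → All.lookup x∉xs z∈xs refl })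
    len′ : length (ys ─ p) ≤ length xs
    len′ = ℕ.s≤s⁻¹ (subst (_≤ suc (length xs)) (length-removeAt′ ys _) len)

sgn-xor : ∀ a b → sgn (a xor b) ≡ sgn a ℤ.* sgn b
sgn-xor false false = refl
sgn-xor false true = refl
sgn-xor true false = refl
sgn-xor true true = refl

sgn² : ∀ b → sgn b ℤ.* sgn b ≡ ℤ.+ 1
sgn² false = refl
sgn² true = refl

∣sgn∣≡1 : ∀ b → ℤ.∣ sgn b ∣ ≡ 1
∣sgn∣≡1 false = refl
∣sgn∣≡1 true = refl

z*-1≡-z : ∀ z → z ℤ.* ℤ.-[1+ 0 ] ≡ ℤ.- z
z*-1≡-z z = trans (ℤP.*-comm z ℤ.-[1+ 0 ]) (ℤP.-1*i≡-i z)

≡-neg⇒0 : ∀ z → z ≡ ℤ.- z → z ≡ ℤ.+ 0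
≡-neg⇒0 (ℤ.+ zero) _ = refl
≡-neg⇒0 (ℤ.+ suc n) ()
≡-neg⇒0 ℤ.-[1+ n ] ()

[a+b]-a≡b : ∀ a b → (a ℤ.+ b) ℤ.- a ≡ b
[a+b]-a≡b = solve 2 (λ a b → (a :+ b) :- a := b) refl
  where open ℤ-Solver.+-*-Solver

ℤ-+-cancelˡ : ∀ a {b c} → a ℤ.+ b ≡ a ℤ.+ c → b ≡ c
ℤ-+-cancelˡ a {b} {c} a+b≡a+c = trans (sym ([a+b]-a≡b a b)) (trans (cong (ℤ._- a) a+b≡a+c) ([a+b]-a≡b a c))

∣z∣≡n⇒z≡±n : ∀ z {n} → ℤ.∣ z ∣ ≡ n → z ≡ ℤ.+ n ⊎ z ≡ ℤ.- (ℤ.+ n)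
∣z∣≡n⇒z≡±n (ℤ.+ _) refl = inj₁ refl
∣z∣≡n⇒z≡±n ℤ.-[1+ _ ] refl = inj₂ refl

does-⇔ : ∀ {P Q : Set} (P? : Dec P) (Q? : Dec Q) → (P → Q) → (Q → P) → does P? ≡ does Q?
does-⇔ (yes _) (yes _) _ _ = refl
does-⇔ (yes p) (no ¬q) P→Q _ = ⊥-elim (¬q (P→Q p))
does-⇔ (no ¬p) (yes q) _ Q→P = ⊥-elim (¬p (Q→P q))
does-⇔ (no _) (no _) _ _ = refl

does≡ : ∀ {P : Set} (P? : Dec P) b → (P → b ≡ true) → (b ≡ true → P) → does P? ≡ b
does≡ (yes p) true _ _ = refl
does≡ (yes p) false P→b _ = sym (P→b p)
does≡ (no ¬p) true _ b→P = ⊥-elim (¬p (b→P refl))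
does≡ (no _) false _ _ = refl

infixr 5 [_]·_
[_]·_ : Bool → ℤ → ℤ
[ b ]· z = if b then z else ℤ.+ 0

[]·-yes : ∀ {P : Set} (P? : Dec P) z → P → [ does P? ]· z ≡ z
[]·-yes P? z p rewrite dec-true P? p = refl

[]·-no : ∀ {P : Set} (P? : Dec P) z → ¬ P → [ does P? ]· z ≡ ℤ.+ 0
[]·-no P? z ¬p rewrite dec-false P? ¬p = refl

[]·-cong : ∀ {P : Set} (P? : Dec P) {z w} → (P → z ≡ w) → [ does P? ]· z ≡ [ does P? ]· w
[]·-cong (yes p) z≡w = z≡w p
[]·-cong (no _) _ = refl

sgn-if : ∀ c X Y → sgn (if c then X else Y) ≡ sgn Y ℤ.+ ([ c ]· (sgn X ℤ.- sgn Y))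
sgn-if true X Y = sym (a+[b-a]≡b (sgn Y) (sgn X))
  where
  open ℤ-Solver.+-*-Solver
  a+[b-a]≡b : ∀ a b → a ℤ.+ (b ℤ.- a) ≡ b
  a+[b-a]≡b = solve 2 (λ a b → a :+ (b :- a) := b) refl
sgn-if false X Y = sym (ℤP.+-identityʳ (sgn Y))


sumMap : (A → ℤ) → List A → ℤ
sumMap g xs = sumℤ (map g xs)

sumMap-cong : ∀ {g h : A → ℤ} xs → (∀ x → g x ≡ h x) → sumMap g xs ≡ sumMap h xs
sumMap-cong [] _ = refl
sumMap-cong (x ∷ xs) g≗h = cong₂ ℤ._+_ (g≗h x) (sumMap-cong xs g≗h)

sumMap-+ : ∀ (g h : A → ℤ) xs → sumMap (λ x → g x ℤ.+ h x) xs ≡ sumMap g xs ℤ.+ sumMap h xs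
sumMap-+ g h [] = refl
sumMap-+ g h (x ∷ xs) = trans (cong (λ s → (g x ℤ.+ h x) ℤ.+ s) (sumMap-+ g h xs))
  (solve 4 (λ a b c d → (a :+ b) :+ (c :+ d) := (a :+ c) :+ (b :+ d)) refl (g x) (h x) (sumMap g xs) (sumMap h xs))
  where open ℤ-Solver.+-*-Solver

sumMap-* : ∀ c (g : A → ℤ) xs → sumMap (λ x → c ℤ.* g x) xs ≡ c ℤ.* sumMap g xs
sumMap-* c g [] = sym (ℤP.*-zeroʳ c)
sumMap-* c g (x ∷ xs) = trans (cong (λ s → c ℤ.* g x ℤ.+ s) (sumMap-* c g xs)) (sym (ℤP.*-distribˡ-+ c (g x) _))

sumMap-neg : ∀ (g : A → ℤ) xs → sumMap (λ x → ℤ.- g x) xs ≡ ℤ.- sumMap g xs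
sumMap-neg g [] = refl
sumMap-neg g (x ∷ xs) = trans (cong (λ s → ℤ.- g x ℤ.+ s) (sumMap-neg g xs)) (sym (ℤP.neg-distrib-+ (g x) _))

sumMap-sub : ∀ (g h : A → ℤ) xs → sumMap (λ x → g x ℤ.- h x) xs ≡ sumMap g xs ℤ.- sumMap h xs
sumMap-sub g h xs = trans (sumMap-+ g (λ x → ℤ.- h x) xs) (cong (λ s → sumMap g xs ℤ.+ s) (sumMap-neg h xs))

sumMap-0 : ∀ (xs : List A) → sumMap (λ _ → ℤ.+ 0) xs ≡ ℤ.+ 0
sumMap-0 [] = refl
sumMap-0 (x ∷ xs) = trans (ℤP.+-identityˡ _) (sumMap-0 xs)

sumMap-swap : ∀ (h : A → B → ℤ) xs ys →
              sumMap (λ x → sumMap (h x) ys) xs ≡ sumMap (λ y → sumMap (λ x → h x y) xs) ys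
sumMap-swap h [] ys = sym (sumMap-0 ys)
sumMap-swap h (x ∷ xs) ys = trans (cong (λ s → sumMap (h x) ys ℤ.+ s) (sumMap-swap h xs ys))
  (sym (sumMap-+ (h x) (λ y → sumMap (λ x′ → h x′ y) xs) ys))

sumMap-filter : ∀ {ℓ} {P : Pred A ℓ} (P? : Decidable P) (g : A → ℤ) xs →
                sumMap g (filter P? xs) ≡ sumMap (λ x → if does (P? x) then g x else ℤ.+ 0) xs
sumMap-filter P? g [] = refl
sumMap-filter P? g (x ∷ xs) with does (P? x)
... | true  = cong (λ s → g x ℤ.+ s) (sumMap-filter P? g xs)
... | false = trans (sumMap-filter P? g xs) (sym (ℤP.+-identityˡ _))

sumMap-map : ∀ (g : B → ℤ) (σ : A → B) xs → sumMap g (map σ xs) ≡ sumMap (λ x → g (σ x)) xs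
sumMap-map g σ [] = refl
sumMap-map g σ (x ∷ xs) = cong (λ s → g (σ x) ℤ.+ s) (sumMap-map g σ xs)

sumMap-⊆ : ∀ (g : A → ℤ) {xs ys} → Unique xs → xs ⊆ ys → length ys ≤ length xs →
           sumMap g ys ≡ sumMap g xs
sumMap-⊆ = FoldComm.fold-⊆ ℤ._+_ (ℤ.+ 0) ℤP.+-assoc ℤP.+-comm

sumMap-[]· : ∀ b (g : A → ℤ) xs → sumMap (λ x → [ b ]· g x) xs ≡ [ b ]· sumMap g xs
sumMap-[]· true g xs = refl
sumMap-[]· false g xs = sumMap-0 xs

sumBelow : ℕ → (ℕ → ℤ) → ℤ
sumBelow zero h = ℤ.+ 0
sumBelow (suc n) h = h 0 ℤ.+ sumBelow n (λ j → h (suc j))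

sumMap-applyUpTo : ∀ (g : A → ℤ) (f : ℕ → A) n → sumMap g (applyUpTo f n) ≡ sumBelow n (λ j → g (f j))
sumMap-applyUpTo g f zero = refl
sumMap-applyUpTo g f (suc n) = cong (λ s → g (f 0) ℤ.+ s) (sumMap-applyUpTo g (λ j → f (suc j)) n)

Unique-applyUpTo : ∀ (f : ℕ → A) n → (∀ {i j} → i < n → j < n → f i ≡ f j → i ≡ j) → Unique (applyUpTo f n)
Unique-applyUpTo f zero _ = []
Unique-applyUpTo f (suc n) inj =
  All.tabulate (λ p f0≡ → let (j , j<n , fj) = ∈-applyUpTo⁻ (λ j → f (suc j)) p in
                 ℕP.0≢1+n (inj (s≤s z≤n) (s≤s j<n) (trans f0≡ fj)))
  ∷ Unique-applyUpTo (λ j → f (suc j)) n (λ i<n j<n e → ℕP.suc-injective (inj (s≤s i<n) (s≤s j<n) e))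

sumBelow-cong : ∀ n {h h′ : ℕ → ℤ} → (∀ j → j < n → h j ≡ h′ j) → sumBelow n h ≡ sumBelow n h′
sumBelow-cong zero _ = refl
sumBelow-cong (suc n) h≗h′ = cong₂ ℤ._+_ (h≗h′ 0 (s≤s z≤n)) (sumBelow-cong n (λ j j<n → h≗h′ (suc j) (s≤s j<n)))

sumBelow-+ : ∀ n (g h : ℕ → ℤ) → sumBelow n (λ j → g j ℤ.+ h j) ≡ sumBelow n g ℤ.+ sumBelow n h
sumBelow-+ zero g h = refl
sumBelow-+ (suc n) g h = trans (cong (λ s → (g 0 ℤ.+ h 0) ℤ.+ s) (sumBelow-+ n _ _))
  (solve 4 (λ a b c d → (a :+ b) :+ (c :+ d) := (a :+ c) :+ (b :+ d)) refl (g 0) (h 0) _ _)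
  where open ℤ-Solver.+-*-Solver

sumBelow-* : ∀ n c (h : ℕ → ℤ) → sumBelow n (λ j → c ℤ.* h j) ≡ c ℤ.* sumBelow n h
sumBelow-* zero c h = sym (ℤP.*-zeroʳ c)
sumBelow-* (suc n) c h = trans (cong (λ s → c ℤ.* h 0 ℤ.+ s) (sumBelow-* n c _)) (sym (ℤP.*-distribˡ-+ c (h 0) _))

sumBelow-sumMap : ∀ n (h : ℕ → A → ℤ) xs →
                  sumBelow n (λ j → sumMap (h j) xs) ≡ sumMap (λ x → sumBelow n (λ j → h j x)) xs
sumBelow-sumMap zero h xs = sym (sumMap-0 xs)
sumBelow-sumMap (suc n) h xs = trans (cong (λ s → sumMap (h 0) xs ℤ.+ s) (sumBelow-sumMap n _ xs))
  (sym (sumMap-+ (h 0) _ xs))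

sumBelow-split : ∀ a b (h : ℕ → ℤ) → sumBelow (a ℕ.+ b) h ≡ sumBelow a h ℤ.+ sumBelow b (λ j → h (a ℕ.+ j))
sumBelow-split zero b h = sym (ℤP.+-identityˡ _)
sumBelow-split (suc a) b h = trans (cong (λ s → h 0 ℤ.+ s) (sumBelow-split a b _))
  (sym (ℤP.+-assoc (h 0) _ _))

sumBelow-last : ∀ n (h : ℕ → ℤ) → sumBelow (suc n) h ≡ sumBelow n h ℤ.+ h n
sumBelow-last n h = begin
  sumBelow (suc n) h                           ≡⟨ cong (λ k → sumBelow k h) (ℕP.+-comm 1 n) ⟩
  sumBelow (n ℕ.+ 1) h                         ≡⟨ sumBelow-split n 1 h ⟩
  sumBelow n h ℤ.+ (h (n ℕ.+ 0) ℤ.+ ℤ.+ 0)     ≡⟨ cong (λ z → sumBelow n h ℤ.+ z) (trans (ℤP.+-identityʳ _) (cong h (ℕP.+-identityʳ n))) ⟩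
  sumBelow n h ℤ.+ h n                         ∎

sumBelow-blocks : ∀ s d (h : ℕ → ℤ) → sumBelow (s ℕ.* d) h ≡ sumBelow s (λ t → sumBelow d (λ j → h (t ℕ.* d ℕ.+ j)))
sumBelow-blocks zero d h = refl
sumBelow-blocks (suc s) d h = trans (sumBelow-split d (s ℕ.* d) h) (cong (λ z → sumBelow d h ℤ.+ z)
  (trans (sumBelow-blocks s d (λ j → h (d ℕ.+ j)))
    (sumBelow-cong s (λ t _ → sumBelow-cong d (λ j _ → cong h (sym (ℕP.+-assoc d (t ℕ.* d) j)))))))

sumBelow-const : ∀ n c → sumBelow n (λ _ → c) ≡ ℤ.+ n ℤ.* c
sumBelow-const zero c = sym (ℤP.*-zeroˡ c)
sumBelow-const (suc n) c = trans (cong (λ s → c ℤ.+ s) (sumBelow-const n c))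
  (trans (cong (ℤ._+ (ℤ.+ n ℤ.* c)) (sym (ℤP.*-identityˡ c))) (sym (ℤP.*-distribʳ-+ c (ℤ.+ 1) (ℤ.+ n))))

sumBelow-periodic : ∀ s d (h : ℕ → ℤ) → (∀ t j → j < d → h (t ℕ.* d ℕ.+ j) ≡ h j) →
                    sumBelow (s ℕ.* d) h ≡ ℤ.+ s ℤ.* sumBelow d h
sumBelow-periodic s d h periodic = trans (sumBelow-blocks s d h)
  (trans (sumBelow-cong s (λ t _ → sumBelow-cong d (periodic t))) (sumBelow-const s _))

sumBelow-head : ∀ n (h : ℕ → ℤ) → (∀ j → j < n → h (suc j) ≡ ℤ.+ 0) → sumBelow (suc n) h ≡ h 0
sumBelow-head n h vanish = trans (cong (λ s → h 0 ℤ.+ s)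
    (trans (sumBelow-cong n vanish) (trans (sumBelow-const n (ℤ.+ 0)) (ℤP.*-zeroʳ (ℤ.+ n)))))
  (ℤP.+-identityʳ _)

sumFin-sumBelow : ∀ n (g : Fin n → ℤ) (h : ℕ → ℤ) → (∀ i → h (toℕ i) ≡ g i) → sumFin g ≡ sumBelow n h
sumFin-sumBelow zero g h _ = refl
sumFin-sumBelow (suc n) g h h∘toℕ≗g = cong₂ ℤ._+_ (sym (h∘toℕ≗g Fin.zero))
  (sumFin-sumBelow n (λ i → g (Fin.suc i)) (λ j → h (suc j)) (λ i → h∘toℕ≗g (Fin.suc i)))

module FieldProperties {k : ℕ} (𝔽 : GF2^ k) where
  open GF2^ 𝔽 public
  open IsCommutativeRing isCommutativeRing public
    using (+-assoc; +-comm; *-assoc; *-comm; +-identityˡ; +-identityʳ;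
           *-identityˡ; *-identityʳ; distribˡ; distribʳ; zeroˡ; zeroʳ)
  commutativeRing : CommutativeRing _ _
  commutativeRing = record { isCommutativeRing = isCommutativeRing }
  open import Tactic.RingSolver.NonReflective (fromCommutativeRing commutativeRing (λ _ → nothing)) public
    using (solve; _⊜_; _⊕_; _⊗_)
  open ≡-Reasoning

  x+x≡0 : ∀ x → x + x ≡ 0#
  x+x≡0 x = begin
    x + x ≡⟨ sym (cong₂ _+_ (*-identityˡ x) (*-identityˡ x)) ⟩
    1# * x + 1# * x ≡⟨ sym (distribʳ x 1# 1#) ⟩
    (1# + 1#) * x ≡⟨ cong (_* x) char2 ⟩
    0# * x ≡⟨ zeroˡ x ⟩
    0# ∎

  x+y≡0⇒x≡y : ∀ {a b} → a + b ≡ 0# → a ≡ b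
  x+y≡0⇒x≡y {a} {b} e = begin
    a ≡⟨ sym (+-identityʳ a) ⟩
    a + 0# ≡⟨ cong (a +_) (sym (x+x≡0 b)) ⟩
    a + (b + b) ≡⟨ sym (+-assoc a b b) ⟩
    (a + b) + b ≡⟨ cong (_+ b) e ⟩
    0# + b ≡⟨ +-identityˡ b ⟩
    b ∎

  x+y+y≡x : ∀ x y → (x + y) + y ≡ x
  x+y+y≡x x y = trans (+-assoc x y y) (trans (cong (x +_) (x+x≡0 y)) (+-identityʳ x))

  x≡y⇒x+y≡0 : ∀ {a b} → a ≡ b → a + b ≡ 0#
  x≡y⇒x+y≡0 {a} refl = x+x≡0 a

  +-cancelʳ : ∀ {a b} c → a + c ≡ b + c → a ≡ b
  +-cancelʳ {a} {b} c e = x+y≡0⇒x≡y (begin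
    a + b ≡⟨ sym (+-identityʳ _) ⟩
    (a + b) + 0# ≡⟨ cong ((a + b) +_) (sym (x+x≡0 c)) ⟩
    (a + b) + (c + c) ≡⟨ solve 3 (λ a b c → ((a ⊕ b) ⊕ (c ⊕ c)) ⊜ ((a ⊕ c) ⊕ (b ⊕ c))) refl a b c ⟩
    (a + c) + (b + c) ≡⟨ x≡y⇒x+y≡0 e ⟩
    0# ∎)

  inverseˡ : ∀ x → x ≢ 0# → x ⁻¹ * x ≡ 1#
  inverseˡ x x≢0 = trans (*-comm _ _) (inverseʳ x x≢0)

  *-cancelˡ : ∀ {x y z} → x ≢ 0# → x * y ≡ x * z → y ≡ z
  *-cancelˡ {x} {y} {z} x≢0 e = begin
    y ≡⟨ sym (*-identityˡ y) ⟩
    1# * y ≡⟨ cong (_* y) (sym (inverseˡ x x≢0)) ⟩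
    (x ⁻¹ * x) * y ≡⟨ *-assoc _ _ _ ⟩
    x ⁻¹ * (x * y) ≡⟨ cong (x ⁻¹ *_) e ⟩
    x ⁻¹ * (x * z) ≡⟨ sym (*-assoc _ _ _) ⟩
    (x ⁻¹ * x) * z ≡⟨ cong (_* z) (inverseˡ x x≢0) ⟩
    1# * z ≡⟨ *-identityˡ z ⟩
    z ∎

  *-cancelʳ : ∀ {x y z} → x ≢ 0# → y * x ≡ z * x → y ≡ z
  *-cancelʳ {x} {y} {z} x≢0 e = *-cancelˡ x≢0 (trans (*-comm x y) (trans e (*-comm z x)))

  *-≢0 : ∀ {x y} → x ≢ 0# → y ≢ 0# → x * y ≢ 0#
  *-≢0 {x} {y} nx ny e = ny (*-cancelˡ nx (trans e (sym (zeroʳ x))))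

  x*y≡0⇒x≡0⊎y≡0 : ∀ {x y} → x * y ≡ 0# → x ≡ 0# ⊎ y ≡ 0#
  x*y≡0⇒x≡0⊎y≡0 {x} {y} e with x ≟ 0# | y ≟ 0#
  ... | yes p | _ = inj₁ p
  ... | no _ | yes q = inj₂ q
  ... | no p | no q = ⊥-elim (*-≢0 p q e)

  1≢0 : 1# ≢ 0#
  1≢0 e = 0≢1 (sym e)

  x*x≡x⇒x≡0⊎x≡1 : ∀ t → t * t ≡ t → t ≡ 0# ⊎ t ≡ 1#
  x*x≡x⇒x≡0⊎x≡1 t e with x*y≡0⇒x≡0⊎y≡0 {t} {t + 1#} (begin
      t * (t + 1#) ≡⟨ distribˡ t t 1# ⟩
      t * t + t * 1# ≡⟨ cong₂ _+_ e (*-identityʳ t) ⟩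
      t + t ≡⟨ x+x≡0 t ⟩
      0# ∎)
  ... | inj₁ p = inj₁ p
  ... | inj₂ p = inj₂ (x+y≡0⇒x≡y p)

  x*y≡1⇒y≡x⁻¹ : ∀ {x y} → x * y ≡ 1# → y ≡ x ⁻¹
  x*y≡1⇒y≡x⁻¹ {x} {y} e with x ≟ 0#
  ... | yes refl = ⊥-elim (0≢1 (trans (sym (zeroˡ y)) e))
  ... | no x≢0 = *-cancelˡ x≢0 (trans e (sym (inverseʳ x x≢0)))

  ⁻¹-≢0 : ∀ {x} → x ≢ 0# → x ⁻¹ ≢ 0#
  ⁻¹-≢0 {x} x≢0 e = 0≢1 (trans (sym (zeroʳ x)) (trans (cong (x *_) (sym e)) (inverseʳ x x≢0)))

  ⁻¹-involutive : ∀ x → x ⁻¹ ⁻¹ ≡ x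
  ⁻¹-involutive x with x ≟ 0#
  ... | yes refl = trans (cong _⁻¹ inv-0) inv-0
  ... | no x≢0 = sym (x*y≡1⇒y≡x⁻¹ (inverseˡ x x≢0))

  1⁻¹≡1 : 1# ⁻¹ ≡ 1#
  1⁻¹≡1 = sym (x*y≡1⇒y≡x⁻¹ (*-identityˡ 1#))

  ⁻¹-distrib-* : ∀ x y → (x * y) ⁻¹ ≡ x ⁻¹ * y ⁻¹
  ⁻¹-distrib-* x y with x ≟ 0# | y ≟ 0#
  ... | yes refl | _ = trans (cong _⁻¹ (zeroˡ y)) (trans inv-0 (sym (trans (cong (_* y ⁻¹) inv-0) (zeroˡ _))))
  ... | no _ | yes refl = trans (cong _⁻¹ (zeroʳ x)) (trans inv-0 (sym (trans (cong (x ⁻¹ *_) inv-0) (zeroʳ _))))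
  ... | no nx | no ny = sym (x*y≡1⇒y≡x⁻¹ (begin
      (x * y) * (x ⁻¹ * y ⁻¹) ≡⟨ solve 4 (λ x y a b → ((x ⊗ y) ⊗ (a ⊗ b)) ⊜ ((x ⊗ a) ⊗ (y ⊗ b))) refl x y (x ⁻¹) (y ⁻¹) ⟩
      (x * x ⁻¹) * (y * y ⁻¹) ≡⟨ cong₂ _*_ (inverseʳ x nx) (inverseʳ y ny) ⟩
      1# * 1# ≡⟨ *-identityˡ 1# ⟩
      1# ∎))

  ^-distribˡ-+-* : ∀ x a b → x ^ (a ℕ.+ b) ≡ x ^ a * x ^ b
  ^-distribˡ-+-* x zero b = sym (*-identityˡ _)
  ^-distribˡ-+-* x (suc a) b = trans (cong (x *_) (^-distribˡ-+-* x a b)) (sym (*-assoc _ _ _))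

  ^-distribʳ-* : ∀ x y a → (x * y) ^ a ≡ x ^ a * y ^ a
  ^-distribʳ-* x y zero = sym (*-identityˡ 1#)
  ^-distribʳ-* x y (suc a) = trans (cong ((x * y) *_) (^-distribʳ-* x y a))
    (solve 4 (λ x y a b → ((x ⊗ y) ⊗ (a ⊗ b)) ⊜ ((x ⊗ a) ⊗ (y ⊗ b))) refl x y (x ^ a) (y ^ a))

  1^ : ∀ b → 1# ^ b ≡ 1#
  1^ zero = refl
  1^ (suc b) = trans (*-identityˡ _) (1^ b)

  ^-* : ∀ x a b → x ^ (a ℕ.* b) ≡ (x ^ a) ^ b
  ^-* x zero b = sym (1^ b)
  ^-* x (suc a) b = begin
    x ^ (b ℕ.+ a ℕ.* b) ≡⟨ ^-distribˡ-+-* x b (a ℕ.* b) ⟩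
    x ^ b * x ^ (a ℕ.* b) ≡⟨ cong (x ^ b *_) (^-* x a b) ⟩
    x ^ b * (x ^ a) ^ b ≡⟨ sym (^-distribʳ-* x (x ^ a) b) ⟩
    (x * x ^ a) ^ b ∎


  ^-identityʳ : ∀ x → x ^ 1 ≡ x
  ^-identityʳ x = *-identityʳ x

  ^-≢0 : ∀ {x} a → x ≢ 0# → x ^ a ≢ 0#
  ^-≢0 zero x≢0 = 1≢0
  ^-≢0 (suc a) x≢0 = *-≢0 x≢0 (^-≢0 a x≢0)

  ^-comm : ∀ x a b → (x ^ a) ^ b ≡ (x ^ b) ^ a
  ^-comm x a b = trans (sym (^-* x a b)) (trans (cong (x ^_) (ℕP.*-comm a b)) (^-* x b a))

  ⁻¹-^ : ∀ x a → (x ⁻¹) ^ a ≡ (x ^ a) ⁻¹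
  ⁻¹-^ x zero = sym 1⁻¹≡1
  ⁻¹-^ x (suc a) = trans (cong (x ⁻¹ *_) (⁻¹-^ x a)) (sym (⁻¹-distrib-* x (x ^ a)))

  x^2≡x*x : ∀ x → x ^ 2 ≡ x * x
  x^2≡x*x x = cong (x *_) (*-identityʳ x)

  square-+ : ∀ x y → (x + y) ^ 2 ≡ x ^ 2 + y ^ 2
  square-+ x y = begin
    (x + y) ^ 2 ≡⟨ x^2≡x*x (x + y) ⟩
    (x + y) * (x + y) ≡⟨ solve 2 (λ x y → ((x ⊕ y) ⊗ (x ⊕ y)) ⊜ ((x ⊗ x ⊕ y ⊗ y) ⊕ (x ⊗ y ⊕ x ⊗ y))) refl x y ⟩
    (x * x + y * y) + (x * y + x * y) ≡⟨ cong ((x * x + y * y) +_) (x+x≡0 (x * y)) ⟩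
    (x * x + y * y) + 0# ≡⟨ +-identityʳ _ ⟩
    x * x + y * y ≡⟨ sym (cong₂ _+_ (x^2≡x*x x) (x^2≡x*x y)) ⟩
    x ^ 2 + y ^ 2 ∎

  0^pos : ∀ a → 0 ℕ.< a → 0# ^ a ≡ 0#
  0^pos (suc a) _ = zeroˡ _

  frobenius : ∀ r x y → (x + y) ^ (2 ℕ.^ r) ≡ x ^ (2 ℕ.^ r) + y ^ (2 ℕ.^ r)
  frobenius zero x y = trans (^-identityʳ _) (sym (cong₂ _+_ (^-identityʳ x) (^-identityʳ y)))
  frobenius (suc r) x y = begin
    (x + y) ^ (2 ℕ.* 2 ℕ.^ r) ≡⟨ ^-* (x + y) 2 (2 ℕ.^ r) ⟩
    ((x + y) ^ 2) ^ (2 ℕ.^ r) ≡⟨ cong (_^ (2 ℕ.^ r)) (square-+ x y) ⟩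
    (x ^ 2 + y ^ 2) ^ (2 ℕ.^ r) ≡⟨ frobenius r (x ^ 2) (y ^ 2) ⟩
    (x ^ 2) ^ (2 ℕ.^ r) + (y ^ 2) ^ (2 ℕ.^ r) ≡⟨ sym (cong₂ _+_ (^-* x 2 (2 ℕ.^ r)) (^-* y 2 (2 ℕ.^ r))) ⟩
    x ^ (2 ℕ.* 2 ℕ.^ r) + y ^ (2 ℕ.* 2 ℕ.^ r) ∎

  0^2^r≡0 : ∀ r → 0# ^ (2 ℕ.^ r) ≡ 0#
  0^2^r≡0 r = 0^pos _ (ℕP.m^n>0 2 r)

  trace-+ : ∀ r x y → trace r (x + y) ≡ trace r x + trace r y
  trace-+ zero x y = sym (+-identityˡ 0#)
  trace-+ (suc r) x y = begin
    (x + y) ^ (2 ℕ.^ r) + trace r (x + y) ≡⟨ cong₂ _+_ (frobenius r x y) (trace-+ r x y) ⟩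
    (x ^ (2 ℕ.^ r) + y ^ (2 ℕ.^ r)) + (trace r x + trace r y)
      ≡⟨ solve 4 (λ a b c d → ((a ⊕ b) ⊕ (c ⊕ d)) ⊜ ((a ⊕ c) ⊕ (b ⊕ d))) refl _ _ _ _ ⟩
    (x ^ (2 ℕ.^ r) + trace r x) + (y ^ (2 ℕ.^ r) + trace r y) ∎

  trace-0 : ∀ r → trace r 0# ≡ 0#
  trace-0 zero = refl
  trace-0 (suc r) = trans (cong₂ _+_ (0^2^r≡0 r) (trace-0 r)) (+-identityˡ 0#)

  trace-^2-+ : ∀ r x → trace r (x ^ 2) + x ≡ trace r x + x ^ (2 ℕ.^ r)
  trace-^2-+ zero x = cong (0# +_) (sym (^-identityʳ x))
  trace-^2-+ (suc r) x = begin
    ((x ^ 2) ^ (2 ℕ.^ r) + trace r (x ^ 2)) + x ≡⟨ +-assoc _ _ _ ⟩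
    (x ^ 2) ^ (2 ℕ.^ r) + (trace r (x ^ 2) + x) ≡⟨ cong₂ _+_ (sym (^-* x 2 (2 ℕ.^ r))) (trace-^2-+ r x) ⟩
    x ^ (2 ℕ.^ suc r) + (trace r x + x ^ (2 ℕ.^ r))
      ≡⟨ solve 3 (λ a b c → (a ⊕ (b ⊕ c)) ⊜ ((c ⊕ b) ⊕ a)) refl _ _ _ ⟩
    (x ^ (2 ℕ.^ r) + trace r x) + x ^ (2 ℕ.^ suc r) ∎

  trace-^2 : ∀ r x → (trace r x) ^ 2 ≡ trace r (x ^ 2)
  trace-^2 zero x = 0^pos 2 (ℕ.s≤s ℕ.z≤n)
  trace-^2 (suc r) x = begin
    (x ^ (2 ℕ.^ r) + trace r x) ^ 2 ≡⟨ square-+ _ _ ⟩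
    (x ^ (2 ℕ.^ r)) ^ 2 + (trace r x) ^ 2 ≡⟨ cong₂ _+_ (^-comm x (2 ℕ.^ r) 2) (trace-^2 r x) ⟩
    (x ^ 2) ^ (2 ℕ.^ r) + trace r (x ^ 2) ∎

  trace-split : ∀ j r y → trace (j ℕ.+ r) y ≡ trace j (y ^ (2 ℕ.^ r)) + trace r y
  trace-split zero r y = sym (+-identityˡ _)
  trace-split (suc j) r y = begin
    y ^ (2 ℕ.^ (j ℕ.+ r)) + trace (j ℕ.+ r) y ≡⟨ cong₂ _+_ e (trace-split j r y) ⟩
    (y ^ (2 ℕ.^ r)) ^ (2 ℕ.^ j) + (trace j (y ^ (2 ℕ.^ r)) + trace r y) ≡⟨ sym (+-assoc _ _ _) ⟩
    ((y ^ (2 ℕ.^ r)) ^ (2 ℕ.^ j) + trace j (y ^ (2 ℕ.^ r))) + trace r y ∎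
    where
    e : y ^ (2 ℕ.^ (j ℕ.+ r)) ≡ (y ^ (2 ℕ.^ r)) ^ (2 ℕ.^ j)
    e = trans (cong (y ^_) (trans (ℕP.^-distribˡ-+-* 2 j r) (ℕP.*-comm (2 ℕ.^ j) (2 ℕ.^ r)))) (^-* y (2 ℕ.^ r) (2 ℕ.^ j))

  trace-0∨1 : ∀ r w → w ^ (2 ℕ.^ r) ≡ w → trace r w ≡ 0# ⊎ trace r w ≡ 1#
  trace-0∨1 r w fix = x*x≡x⇒x≡0⊎x≡1 _ (trans (sym (x^2≡x*x _)) (trans (trace-^2 r w) e))
    where
    e : trace r (w ^ 2) ≡ trace r w
    e = +-cancelʳ w (trans (trace-^2-+ r w) (cong (trace r w +_) fix))

  bit-0 : bit 0# ≡ false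
  bit-0 with 0# ≟ 0#
  ... | yes _ = refl
  ... | no ne = ⊥-elim (ne refl)

  bit-1 : bit 1# ≡ true
  bit-1 with 1# ≟ 0#
  ... | yes e = ⊥-elim (1≢0 e)
  ... | no ne = refl

  bit-+ : ∀ {a b} → a ≡ 0# ⊎ a ≡ 1# → b ≡ 0# ⊎ b ≡ 1# → bit (a + b) ≡ bit a xor bit b
  bit-+ (inj₁ refl) (inj₁ refl) = trans (cong bit (+-identityˡ 0#)) (trans bit-0 (sym (cong₂ _xor_ bit-0 bit-0)))
  bit-+ (inj₁ refl) (inj₂ refl) = trans (cong bit (+-identityˡ 1#)) (trans bit-1 (sym (cong₂ _xor_ bit-0 bit-1)))
  bit-+ (inj₂ refl) (inj₁ refl) = trans (cong bit (+-identityʳ 1#)) (trans bit-1 (sym (cong₂ _xor_ bit-1 bit-0)))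
  bit-+ (inj₂ refl) (inj₂ refl) = trans (cong bit char2) (trans bit-0 (sym (cong₂ _xor_ bit-1 bit-1)))

  ^-*-≡1 : ∀ {x} d t → x ^ d ≡ 1# → x ^ (t ℕ.* d) ≡ 1#
  ^-*-≡1 {x} d t e = trans (cong (x ^_) (ℕP.*-comm t d)) (trans (^-* x d t) (trans (cong (_^ t) e) (1^ t)))

  ^-period : ∀ {x} d t j → x ^ d ≡ 1# → x ^ (t ℕ.* d ℕ.+ j) ≡ x ^ j
  ^-period {x} d t j e = trans (^-distribˡ-+-* x (t ℕ.* d) j) (trans (cong (_* x ^ j) (^-*-≡1 d t e)) (*-identityˡ _))

  ^-*′ : ∀ x a b → x ^ (a ℕ.* b) ≡ (x ^ b) ^ a
  ^-*′ x a b = trans (cong (x ^_) (ℕP.*-comm a b)) (^-* x b a)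

  sumF : ℕ → (ℕ → F) → F
  sumF zero h = 0#
  sumF (suc n) h = h n + sumF n h

  trace-sumF : ∀ r y → trace r y ≡ sumF r (λ i → y ^ (2 ℕ.^ i))
  trace-sumF zero y = refl
  trace-sumF (suc r) y = cong (y ^ (2 ℕ.^ r) +_) (trace-sumF r y)

  sumF-cong : ∀ n {h h' : ℕ → F} → (∀ i → i ℕ.< n → h i ≡ h' i) → sumF n h ≡ sumF n h'
  sumF-cong zero e = refl
  sumF-cong (suc n) e = cong₂ _+_ (e n (ℕP.n<1+n n)) (sumF-cong n (λ i lt → e i (ℕP.m<n⇒m<1+n lt)))

  sumF-*ʳ : ∀ n h c → sumF n h * c ≡ sumF n (λ i → h i * c)
  sumF-*ʳ zero h c = zeroˡ c
  sumF-*ʳ (suc n) h c = trans (distribʳ c (h n) (sumF n h)) (cong (h n * c +_) (sumF-*ʳ n h c))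

  sumF-+ : ∀ n g h → sumF n (λ i → g i + h i) ≡ sumF n g + sumF n h
  sumF-+ zero g h = sym (+-identityˡ 0#)
  sumF-+ (suc n) g h = trans (cong ((g n + h n) +_) (sumF-+ n g h))
    (solve 4 (λ a b c d → ((a ⊕ b) ⊕ (c ⊕ d)) ⊜ ((a ⊕ c) ⊕ (b ⊕ d))) refl (g n) (h n) (sumF n g) (sumF n h))

  sumF-0 : ∀ n → sumF n (λ _ → 0#) ≡ 0#
  sumF-0 zero = refl
  sumF-0 (suc n) = trans (+-identityˡ _) (sumF-0 n)

  sumF-swap : ∀ a b (h : ℕ → ℕ → F) → sumF a (λ e → sumF b (λ i → h e i)) ≡ sumF b (λ i → sumF a (λ e → h e i))
  sumF-swap zero b h = sym (sumF-0 b)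
  sumF-swap (suc a) b h = trans (cong (sumF b (h a) +_) (sumF-swap a b h)) (sym (sumF-+ b (h a) (λ i → sumF a (λ e → h e i))))

  sumF-head : ∀ n (h : ℕ → F) → (∀ i → 0 ℕ.< i → i ℕ.< suc n → h i ≡ 0#) → sumF (suc n) h ≡ h 0
  sumF-head zero h e = +-identityʳ _
  sumF-head (suc n) h e = trans (cong₂ _+_ (e (suc n) (ℕ.s≤s ℕ.z≤n) (ℕP.n<1+n _)) (sumF-head n h (λ i p lt → e i p (ℕP.m<n⇒m<1+n lt))))
    (+-identityˡ _)

  geometric-sum : ∀ γ d → (γ + 1#) * sumF d (λ e → γ ^ e) ≡ γ ^ d + 1#
  geometric-sum γ zero = trans (zeroʳ _) (sym char2)
  geometric-sum γ (suc d) = begin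
    (γ + 1#) * (γ ^ d + sumF d (λ e → γ ^ e)) ≡⟨ distribˡ _ _ _ ⟩
    (γ + 1#) * γ ^ d + (γ + 1#) * sumF d (λ e → γ ^ e) ≡⟨ cong ((γ + 1#) * γ ^ d +_) (geometric-sum γ d) ⟩
    (γ + 1#) * γ ^ d + (γ ^ d + 1#) ≡⟨ cong (_+ (γ ^ d + 1#)) (trans (distribʳ _ _ _) (cong (γ * γ ^ d +_) (*-identityˡ _))) ⟩
    (γ * γ ^ d + γ ^ d) + (γ ^ d + 1#) ≡⟨ solve 3 (λ a b c → ((a ⊕ b) ⊕ (b ⊕ c)) ⊜ (a ⊕ c ⊕ (b ⊕ b))) refl (γ * γ ^ d) (γ ^ d) 1# ⟩
    γ * γ ^ d + 1# + (γ ^ d + γ ^ d) ≡⟨ cong (γ * γ ^ d + 1# +_) (x+x≡0 _) ⟩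
    γ * γ ^ d + 1# + 0# ≡⟨ +-identityʳ _ ⟩
    γ ^ suc d + 1# ∎

  geometric-sum≡0 : ∀ γ d → γ ^ d ≡ 1# → γ ≢ 1# → sumF d (λ e → γ ^ e) ≡ 0#
  geometric-sum≡0 γ d e ne with x*y≡0⇒x≡0⊎y≡0 {γ + 1#} {sumF d (λ e → γ ^ e)} (trans (geometric-sum γ d) (trans (cong (_+ 1#) e) char2))
  ... | inj₁ p = ⊥-elim (ne (x+y≡0⇒x≡y p))
  ... | inj₂ p = p

  sumF-1-odd : ∀ s → sumF (3 ℕ.+ 2 ℕ.* s) (λ _ → 1#) ≡ 1#
  sumF-1-odd zero = trans (sym (+-assoc 1# 1# (1# + 0#))) (trans (cong (_+ (1# + 0#)) char2) (trans (+-identityˡ _) (+-identityʳ _)))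
  sumF-1-odd (suc s) = trans (cong (λ n → sumF n (λ _ → 1#)) (cong (3 ℕ.+_) (ℕP.*-suc 2 s)))
    (trans (sym (+-assoc 1# 1# _)) (trans (cong (_+ sumF (3 ℕ.+ 2 ℕ.* s) (λ _ → 1#)) char2)
      (trans (+-identityˡ _) (sumF-1-odd s))))

module PrimitiveElement {k : ℕ} (𝔽 : GF2^ k) (M′ : ℕ) (size≡ : 2 ℕ.^ k ≡ suc (suc M′))
                        (ω : GF2^.F 𝔽) (ω-primitive : GF2^.IsPrimitive 𝔽 ω) (ω≢0 : ω ≢ GF2^.0# 𝔽) where
  open FieldProperties 𝔽

  M : ℕ
  M = suc M′

  N : ℕ
  N = suc M

  length-elems : length elems ≡ N
  length-elems = trans size size≡

  nonzero : List F
  nonzero = filter (λ x → ¬? (x ≟ 0#)) elems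

  Unique-nonzero : Unique nonzero
  Unique-nonzero = Unique.filter⁺ (λ x → ¬? (x ≟ 0#)) unique

  ∈-nonzero : ∀ {x} → x ≢ 0# → x ∈ₗ nonzero
  ∈-nonzero {x} x≢0 = ∈-filter⁺ (λ x → ¬? (x ≟ 0#)) (complete x) x≢0

  nonzero-≢0 : ∀ {x} → x ∈ₗ nonzero → x ≢ 0#
  nonzero-≢0 p = proj₂ (∈-filter⁻ (λ x → ¬? (x ≟ 0#)) {xs = elems} p)

  0∷nonzero-complete : ∀ x → x ∈ₗ 0# ∷ nonzero
  0∷nonzero-complete x with x ≟ 0#
  ... | yes x≡0 = here x≡0
  ... | no x≢0 = there (∈-nonzero x≢0)

  length-nonzero : length nonzero ≡ M
  length-nonzero = ℕP.suc-injective (ℕP.≤-antisym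
    (subst (suc (length nonzero) ≤_) length-elems (Unique⇒length≤ Unique-0∷nonzero (λ {z} _ → complete z)))
    (subst (_≤ suc (length nonzero)) length-elems (Unique⇒length≤ unique (λ {z} _ → 0∷nonzero-complete z))))
    where
    Unique-0∷nonzero : Unique (0# ∷ nonzero)
    Unique-0∷nonzero = All.tabulate (λ p 0≡x → nonzero-≢0 p (sym 0≡x)) ∷ Unique-nonzero

  module Product = FoldComm _*_ 1# *-assoc *-comm

  product : List F → F
  product xs = Product.fold (map (λ x → x) xs)

  product-scale : ∀ c xs → product (map (c *_) xs) ≡ c ^ length xs * product xs
  product-scale c [] = sym (*-identityˡ 1#)
  product-scale c (x ∷ xs) = trans (cong ((c * x) *_) (product-scale c xs))
    (solve 4 (λ c x a p → ((c ⊗ x) ⊗ (a ⊗ p)) ⊜ ((c ⊗ a) ⊗ (x ⊗ p))) refl c x (c ^ length xs) (product xs))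

  product-≢0 : ∀ xs → (∀ {x} → x ∈ₗ xs → x ≢ 0#) → product xs ≢ 0#
  product-≢0 [] _ = 1≢0
  product-≢0 (x ∷ xs) xs≢0 = *-≢0 (xs≢0 (here refl)) (product-≢0 xs (λ p → xs≢0 (there p)))

  -- Multiplication by ω permutes the nonzero elements, so it fixes their product.
  ω^M≡1 : ω ^ M ≡ 1#
  ω^M≡1 = *-cancelʳ (product-≢0 nonzero nonzero-≢0) (begin
      ω ^ M * product nonzero               ≡⟨ cong (λ e → ω ^ e * product nonzero) (sym length-nonzero) ⟩
      ω ^ length nonzero * product nonzero  ≡⟨ sym (product-scale ω nonzero) ⟩
      product (map (ω *_) nonzero)          ≡⟨ Product.fold-⊆ (λ x → x) Unique-nonzero ⊆ω·nonzero
                                                 (ℕP.≤-reflexive (length-map (ω *_) nonzero)) ⟩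
      product nonzero                       ≡⟨ sym (*-identityˡ _) ⟩
      1# * product nonzero                  ∎)
    where
    ⊆ω·nonzero : nonzero ⊆ map (ω *_) nonzero
    ⊆ω·nonzero {z} p = subst (_∈ₗ map (ω *_) nonzero) ω·ω⁻¹z≡z
      (∈-map⁺ (ω *_) (∈-nonzero (*-≢0 (⁻¹-≢0 ω≢0) (nonzero-≢0 p))))
      where
      ω·ω⁻¹z≡z : ω * (ω ⁻¹ * z) ≡ z
      ω·ω⁻¹z≡z = trans (sym (*-assoc _ _ _)) (trans (cong (_* z) (inverseʳ ω ω≢0)) (*-identityˡ z))

  ^-% : ∀ {x} d .{{_ : ℕ.NonZero d}} e → x ^ d ≡ 1# → x ^ e ≡ x ^ (e % d)
  ^-% {x} d e x^d≡1 = trans (cong (x ^_) (trans (m≡m%n+[m/n]*n e d) (ℕP.+-comm (e % d) _)))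
    (^-period d (e / d) (e % d) x^d≡1)

  ω^d≡1⇒M≤d : ∀ d → 0 < d → ω ^ d ≡ 1# → M ≤ d
  ω^d≡1⇒M≤d d@(suc _) _ ω^d≡1 = ℕ.s≤s⁻¹ (subst (_≤ suc d) length-elems
      (subst (length elems ≤_) (cong suc (length-applyUpTo (ω ^_) d)) (Unique⇒length≤ unique ⊆powers)))
    where
    ⊆powers : elems ⊆ 0# ∷ applyUpTo (ω ^_) d
    ⊆powers {z} _ with z ≟ 0#
    ... | yes z≡0 = here z≡0
    ... | no z≢0 with ω-primitive z z≢0
    ... | e , ω^e≡z = there (subst (_∈ₗ applyUpTo (ω ^_) d) (trans (sym (^-% d e ω^d≡1)) ω^e≡z)
                                   (∈-applyUpTo⁺ (ω ^_) (m%n<n e d)))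

  private
    ω^-injective-< : ∀ {i j} → i < j → j < M → ω ^ i ≢ ω ^ j
    ω^-injective-< {i} {j} i<j j<M ω^i≡ω^j = ℕP.<⇒≱ (ℕP.≤-<-trans (ℕP.m∸n≤m j i) j<M)
      (ω^d≡1⇒M≤d (j ℕ.∸ i) (ℕP.m<n⇒0<n∸m i<j) (*-cancelˡ (^-≢0 i ω≢0) (begin
        ω ^ i * ω ^ (j ℕ.∸ i)    ≡⟨ sym (^-distribˡ-+-* ω i (j ℕ.∸ i)) ⟩
        ω ^ (i ℕ.+ (j ℕ.∸ i))    ≡⟨ cong (ω ^_) (ℕP.m+[n∸m]≡n (ℕP.<⇒≤ i<j)) ⟩
        ω ^ j                    ≡⟨ sym ω^i≡ω^j ⟩
        ω ^ i                    ≡⟨ sym (*-identityʳ _) ⟩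
        ω ^ i * 1#               ∎)))

  ω^-injective : ∀ {i j} → i < M → j < M → ω ^ i ≡ ω ^ j → i ≡ j
  ω^-injective {i} {j} i<M j<M ω^i≡ω^j with ℕP.<-cmp i j
  ... | tri≈ _ i≡j _ = i≡j
  ... | tri< i<j _ _ = ⊥-elim (ω^-injective-< i<j j<M ω^i≡ω^j)
  ... | tri> _ _ j<i = ⊥-elim (ω^-injective-< j<i i<M (sym ω^i≡ω^j))

  ω^≡1⇒M∣ : ∀ a → ω ^ a ≡ 1# → M ∣ a
  ω^≡1⇒M∣ a ω^a≡1 = m%n≡0⇒n∣m a M (ω^-injective (m%n<n a M) (s≤s z≤n) (trans (sym (^-% M a ω^M≡1)) ω^a≡1))

  discreteLog : ∀ {x} → x ≢ 0# → ∃ λ e → e < M × ω ^ e ≡ x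
  discreteLog {x} x≢0 with ω-primitive x x≢0
  ... | e , ω^e≡x = e % M , m%n<n e M , trans (sym (^-% M e ω^M≡1)) ω^e≡x

  x^M≡1 : ∀ {x} → x ≢ 0# → x ^ M ≡ 1#
  x^M≡1 x≢0 with discreteLog x≢0
  ... | e , _ , refl = trans (^-comm ω e M) (trans (cong (_^ e) ω^M≡1) (1^ e))

  x^N≡x : ∀ x → x ^ N ≡ x
  x^N≡x x with x ≟ 0#
  ... | yes refl = zeroˡ _
  ... | no x≢0 = trans (cong (x *_) (x^M≡1 x≢0)) (*-identityʳ x)

  sum-elems-ω^ : (g : F → ℤ) → sumMap g elems ≡ g 0# ℤ.+ sumBelow M (λ e → g (ω ^ e))
  sum-elems-ω^ g = trans (sym (sumMap-⊆ g unique ⊆powers length≤))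
      (cong (λ s → g 0# ℤ.+ s) (sumMap-applyUpTo g (ω ^_) M))
    where
    ⊆powers : elems ⊆ 0# ∷ applyUpTo (ω ^_) M
    ⊆powers {z} _ with z ≟ 0#
    ... | yes z≡0 = here z≡0
    ... | no z≢0 with discreteLog z≢0
    ... | e , e<M , ω^e≡z = there (subst (_∈ₗ applyUpTo (ω ^_) M) ω^e≡z (∈-applyUpTo⁺ (ω ^_) e<M))
    length≤ : suc (length (applyUpTo (ω ^_) M)) ≤ length elems
    length≤ = ℕP.≤-reflexive (trans (cong suc (length-applyUpTo (ω ^_) M)) (sym length-elems))

  sum-elems-reindex : (g : F → ℤ) (σ τ : F → F) → (∀ x → σ (τ x) ≡ x) → sumMap (λ x → g (σ x)) elems ≡ sumMap g elems
  sum-elems-reindex g σ τ σ∘τ≗id = trans (sym (sumMap-map g σ elems))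
    (sumMap-⊆ g unique (λ {z} _ → subst (_∈ₗ map σ elems) (σ∘τ≗id z) (∈-map⁺ σ (complete (τ z))))
      (ℕP.≤-reflexive (length-map σ elems)))

-- q = 2^m is written 4 + 2s, so that q - 1 = 3 + 2s and q + 1 = 5 + 2s are literal successors.
module Setting (m s : ℕ) (q≡4+2s : 2 ℕ.^ m ≡ 4 ℕ.+ 2 ℕ.* s) (𝔽 : GF2^ (2 ℕ.* m))
               (ω : GF2^.F 𝔽) (ω-primitive : GF2^.IsPrimitive 𝔽 ω) where
  open FieldProperties 𝔽
  open ℕ-Solver.+-*-Solver using (_:+_; _:*_; _:=_; con)
  module ℕS = ℕ-Solver.+-*-Solver
  module ℤS = ℤ-Solver.+-*-Solver

  q : ℕ
  q = 2 ℕ.^ m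
  q-1 : ℕ
  q-1 = 3 ℕ.+ 2 ℕ.* s
  q+1 : ℕ
  q+1 = 5 ℕ.+ 2 ℕ.* s
  q²-1 : ℕ
  q²-1 = q-1 ℕ.* q+1

  2^[2m]≡q*q : 2 ℕ.^ (2 ℕ.* m) ≡ q ℕ.* q
  2^[2m]≡q*q = trans (cong (2 ℕ.^_) (cong (m ℕ.+_) (ℕP.+-identityʳ m))) (ℕP.^-distribˡ-+-* 2 m m)

  size-shape : 2 ℕ.^ (2 ℕ.* m) ≡ suc (suc (q²-1 ℕ.∸ 1))
  size-shape = trans 2^[2m]≡q*q (trans (cong₂ ℕ._*_ q≡4+2s q≡4+2s)
    (ℕS.solve 1 (λ s → (con 4 :+ con 2 :* s) :* (con 4 :+ con 2 :* s) := con 1 :+ (con 3 :+ con 2 :* s) :* (con 5 :+ con 2 :* s))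
      refl s))

  m≢0 : m ≢ 0
  m≢0 m≡0 = case trans (cong (2 ℕ.^_) (sym m≡0)) q≡4+2s of λ ()

  ω≢0 : ω ≢ 0#
  ω≢0 refl = ℕP.<⇒≱ 2<size (subst (_≤ 2) size (Unique⇒length≤ unique elems⊆0∷1))
    where
    2<size : 2 < 2 ℕ.^ (2 ℕ.* m)
    2<size = subst (2 <_) (sym size-shape) (s≤s (s≤s (s≤s z≤n)))
    elems⊆0∷1 : elems ⊆ 0# ∷ 1# ∷ []
    elems⊆0∷1 {z} _ with z ≟ 0#
    ... | yes z≡0 = here z≡0
    ... | no z≢0 with ω-primitive z z≢0
    ... | zero , 1≡z = there (here (sym 1≡z))
    ... | suc j , 0≡z = ⊥-elim (z≢0 (trans (sym 0≡z) (zeroˡ _)))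

  open PrimitiveElement 𝔽 (q²-1 ℕ.∸ 1) size-shape ω ω-primitive ω≢0 public

  q∸1≡q-1 : q ℕ.∸ 1 ≡ q-1
  q∸1≡q-1 = cong (ℕ._∸ 1) q≡4+2s

  x^[q∸1]≡x^[q-1] : ∀ x → x ^ (q ℕ.∸ 1) ≡ x ^ q-1
  x^[q∸1]≡x^[q-1] x = cong (x ^_) q∸1≡q-1

  v : F
  v = ω ^ q-1
  β : F
  β = ω ^ q+1

  v^q+1 : v ^ q+1 ≡ 1#
  v^q+1 = trans (sym (^-* ω q-1 q+1)) ω^M≡1

  β^q-1 : β ^ q-1 ≡ 1#
  β^q-1 = trans (sym (^-* ω q+1 q-1)) (trans (cong (ω ^_) (ℕP.*-comm q+1 q-1)) ω^M≡1)

  ^q≡⁻¹ : ∀ {x} → x ^ q+1 ≡ 1# → x ^ q ≡ x ⁻¹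
  ^q≡⁻¹ {x} x^[q+1]≡1 = x*y≡1⇒y≡x⁻¹ (trans (cong (x ^_) (cong suc q≡4+2s)) x^[q+1]≡1)

  v≢0 : v ≢ 0#
  v≢0 = ^-≢0 q-1 ω≢0
  β≢0 : β ≢ 0#
  β≢0 = ^-≢0 q+1 ω≢0

  v^a≢1 : ∀ a → 0 < a → a < q+1 → v ^ a ≢ 1#
  v^a≢1 a 0<a a<q+1 v^a≡1 = ℕP.<⇒≱ (ℕP.*-monoʳ-< q-1 a<q+1)
    (ω^d≡1⇒M≤d (q-1 ℕ.* a) (subst (_< q-1 ℕ.* a) (ℕP.*-zeroʳ q-1) (ℕP.*-monoʳ-< q-1 0<a)) (trans (^-* ω q-1 a) v^a≡1))

  β^a≢1 : ∀ a → 0 < a → a < q-1 → β ^ a ≢ 1#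
  β^a≢1 a 0<a a<q-1 β^a≡1 = ℕP.<⇒≱ (subst (q+1 ℕ.* a <_) (ℕP.*-comm q+1 q-1) (ℕP.*-monoʳ-< q+1 a<q-1))
    (ω^d≡1⇒M≤d (q+1 ℕ.* a) (subst (_< q+1 ℕ.* a) (ℕP.*-zeroʳ q+1) (ℕP.*-monoʳ-< q+1 0<a)) (trans (^-* ω q+1 a) β^a≡1))

  x^q≡x*x^[q-1] : ∀ x → x ^ q ≡ x * x ^ q-1
  x^q≡x*x^[q-1] x = cong (x ^_) q≡4+2s

  0^q≡0 : 0# ^ q ≡ 0#
  0^q≡0 = trans (x^q≡x*x^[q-1] 0#) (zeroˡ _)

  Fq*⇒^[q-1]≡1 : ∀ {x} → x ≢ 0# → x ^ q ≡ x → x ^ q-1 ≡ 1#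
  Fq*⇒^[q-1]≡1 {x} x≢0 x∈Fq = *-cancelˡ x≢0 (trans (sym (x^q≡x*x^[q-1] x)) (trans x∈Fq (sym (*-identityʳ x))))

  ^[q-1]≡1⇒Fq : ∀ {x} → x ^ q-1 ≡ 1# → x ^ q ≡ x
  ^[q-1]≡1⇒Fq {x} x^[q-1]≡1 = trans (x^q≡x*x^[q-1] x) (trans (cong (x *_) x^[q-1]≡1) (*-identityʳ x))

  β^-Fq : ∀ t → (β ^ t) ^ q ≡ β ^ t
  β^-Fq t = ^[q-1]≡1⇒Fq (trans (^-comm β t q-1) (trans (cong (_^ t) β^q-1) (1^ t)))

  sumFq : (F → ℤ) → ℤ
  sumFq h = sumMap (λ x → [ does ((x ^ q) ≟ x) ]· h x) elems

  -- ω^e lies in F_q exactly when q + 1 divides e, so each block of q + 1 exponents contributes its first term.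
  sumFq-β^ : (h : F → ℤ) → sumFq h ≡ h 0# ℤ.+ sumBelow q-1 (λ t → h (β ^ t))
  sumFq-β^ h = begin
    sumFq h
      ≡⟨ sum-elems-ω^ g ⟩
    g 0# ℤ.+ sumBelow q²-1 (λ e → g (ω ^ e))
      ≡⟨ cong₂ ℤ._+_ ([]·-yes ((0# ^ q) ≟ 0#) (h 0#) 0^q≡0) (sumBelow-blocks q-1 q+1 (λ e → g (ω ^ e))) ⟩
    h 0# ℤ.+ sumBelow q-1 (λ t → sumBelow q+1 (λ j → g (ω ^ (t ℕ.* q+1 ℕ.+ j))))
      ≡⟨ cong (λ z → h 0# ℤ.+ z) (sumBelow-cong q-1 (λ t _ → block t)) ⟩
    h 0# ℤ.+ sumBelow q-1 (λ t → h (β ^ t)) ∎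
    where
    g : F → ℤ
    g x = [ does ((x ^ q) ≟ x) ]· h x
    block : ∀ t → sumBelow q+1 (λ j → g (ω ^ (t ℕ.* q+1 ℕ.+ j))) ≡ h (β ^ t)
    block t = trans (sumBelow-head (4 ℕ.+ 2 ℕ.* s) (λ j → g (ω ^ (t ℕ.* q+1 ℕ.+ j))) off-Fq)
      (trans (cong g ω^[t*[q+1]]≡β^t) ([]·-yes (((β ^ t) ^ q) ≟ (β ^ t)) _ (β^-Fq t)))
      where
      ω^[t*[q+1]]≡β^t : ω ^ (t ℕ.* q+1 ℕ.+ 0) ≡ β ^ t
      ω^[t*[q+1]]≡β^t = trans (cong (ω ^_) (ℕP.+-identityʳ (t ℕ.* q+1))) (^-*′ ω t q+1)
      off-Fq : ∀ j → j < 4 ℕ.+ 2 ℕ.* s → g (ω ^ (t ℕ.* q+1 ℕ.+ suc j)) ≡ ℤ.+ 0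
      off-Fq j j<q = []·-no ((x ^ q) ≟ x) (h x) (λ x∈Fq → v^a≢1 (suc j) (s≤s z≤n) (s≤s j<q)
          (trans (sym (^-period q+1 t (suc j) v^q+1))
            (trans (^-comm ω q-1 (t ℕ.* q+1 ℕ.+ suc j)) (Fq*⇒^[q-1]≡1 (^-≢0 (t ℕ.* q+1 ℕ.+ suc j) ω≢0) x∈Fq))))
        where
        x : F
        x = ω ^ (t ℕ.* q+1 ℕ.+ suc j)

  sumBelow-β^ : (h : F → ℤ) → sumBelow q-1 (λ t → h (β ^ t)) ≡ sumFq h ℤ.- h 0#
  sumBelow-β^ h = sym (trans (cong (ℤ._- h 0#) (sumFq-β^ h)) ([a+b]-a≡b (h 0#) _))

  sum-norm : (h : F → ℤ) → sumMap (λ y → h (y ^ q+1)) elems ≡ h 0# ℤ.+ ℤ.+ q+1 ℤ.* sumBelow q-1 (λ t → h (β ^ t))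
  sum-norm h = begin
    sumMap (λ y → h (y ^ q+1)) elems
      ≡⟨ sum-elems-ω^ (λ y → h (y ^ q+1)) ⟩
    h (0# ^ q+1) ℤ.+ sumBelow q²-1 (λ e → h ((ω ^ e) ^ q+1))
      ≡⟨ cong₂ ℤ._+_ (cong h (zeroˡ _)) (sumBelow-cong q²-1 (λ e _ → cong h (^-comm ω e q+1))) ⟩
    h 0# ℤ.+ sumBelow q²-1 (λ e → h (β ^ e))
      ≡⟨ cong (λ z → h 0# ℤ.+ z) (trans (cong (λ n → sumBelow n (λ e → h (β ^ e))) (ℕP.*-comm q-1 q+1))
           (sumBelow-periodic q+1 q-1 (λ e → h (β ^ e)) (λ t j _ → cong h (^-period q-1 t j β^q-1)))) ⟩
    h 0# ℤ.+ ℤ.+ q+1 ℤ.* sumBelow q-1 (λ t → h (β ^ t)) ∎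

  -- ω^e lies in μ_(q+1) exactly when q - 1 divides e.
  sum-μ : (h : F → ℤ) → sumMap (λ y → [ does ((y ^ q+1) ≟ 1#) ]· h y) elems ≡ sumBelow q+1 (λ r → h (v ^ r))
  sum-μ h = begin
    sumMap g elems
      ≡⟨ sum-elems-ω^ g ⟩
    g 0# ℤ.+ sumBelow q²-1 (λ e → g (ω ^ e))
      ≡⟨ cong₂ ℤ._+_ ([]·-no ((0# ^ q+1) ≟ 1#) (h 0#) (λ 0≡1 → 0≢1 (trans (sym (zeroˡ _)) 0≡1)))
           (cong (λ n → sumBelow n (λ e → g (ω ^ e))) (ℕP.*-comm q-1 q+1)) ⟩
    ℤ.+ 0 ℤ.+ sumBelow (q+1 ℕ.* q-1) (λ e → g (ω ^ e))
      ≡⟨ trans (ℤP.+-identityˡ _) (sumBelow-blocks q+1 q-1 (λ e → g (ω ^ e))) ⟩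
    sumBelow q+1 (λ t → sumBelow q-1 (λ j → g (ω ^ (t ℕ.* q-1 ℕ.+ j))))
      ≡⟨ sumBelow-cong q+1 (λ t _ → block t) ⟩
    sumBelow q+1 (λ r → h (v ^ r)) ∎
    where
    g : F → ℤ
    g y = [ does ((y ^ q+1) ≟ 1#) ]· h y
    block : ∀ t → sumBelow q-1 (λ j → g (ω ^ (t ℕ.* q-1 ℕ.+ j))) ≡ h (v ^ t)
    block t = trans (sumBelow-head (2 ℕ.+ 2 ℕ.* s) (λ j → g (ω ^ (t ℕ.* q-1 ℕ.+ j))) off-μ)
      (trans (cong g ω^[t*[q-1]]≡v^t)
        ([]·-yes (((v ^ t) ^ q+1) ≟ 1#) _ (trans (^-comm v t q+1) (trans (cong (_^ t) v^q+1) (1^ t)))))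
      where
      ω^[t*[q-1]]≡v^t : ω ^ (t ℕ.* q-1 ℕ.+ 0) ≡ v ^ t
      ω^[t*[q-1]]≡v^t = trans (cong (ω ^_) (ℕP.+-identityʳ (t ℕ.* q-1))) (^-*′ ω t q-1)
      off-μ : ∀ j → j < 2 ℕ.+ 2 ℕ.* s → g (ω ^ (t ℕ.* q-1 ℕ.+ suc j)) ≡ ℤ.+ 0
      off-μ j j<q-2 = []·-no ((x ^ q+1) ≟ 1#) (h x) (λ x∈μ → β^a≢1 (suc j) (s≤s z≤n) (s≤s j<q-2)
          (trans (sym (^-period q-1 t (suc j) β^q-1)) (trans (^-comm ω q+1 (t ℕ.* q-1 ℕ.+ suc j)) x∈μ)))
        where
        x : F
        x = ω ^ (t ℕ.* q-1 ℕ.+ suc j)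

  sum-v^-periodic : (H : F → ℤ) → sumBelow q²-1 (λ e → H (v ^ e)) ≡ ℤ.+ q-1 ℤ.* sumBelow q+1 (λ r → H (v ^ r))
  sum-v^-periodic H = sumBelow-periodic q-1 q+1 (λ e → H (v ^ e)) (λ t j _ → cong H (^-period q+1 t j v^q+1))

  sumFq-1 : sumFq (λ _ → ℤ.+ 1) ≡ ℤ.+ q
  sumFq-1 = trans (sumFq-β^ (λ _ → ℤ.+ 1))
    (trans (cong (λ z → ℤ.+ 1 ℤ.+ z) (trans (sumBelow-const q-1 (ℤ.+ 1)) (ℤP.*-identityʳ (ℤ.+ q-1))))
      (cong ℤ.+_ (sym q≡4+2s)))

  χ : F → ℤ
  χ y = sgn (Tr y)

  χq : F → ℤ
  χq y = sgn (bit (trace m y))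

  q*q≡N : q ℕ.* q ≡ N
  q*q≡N = trans (sym 2^[2m]≡q*q) size-shape

  ^q-involutive : ∀ y → (y ^ q) ^ q ≡ y
  ^q-involutive y = trans (sym (^-* y q q)) (trans (cong (y ^_) q*q≡N) (x^N≡x y))

  frobenius-q : ∀ x y → (x + y) ^ q ≡ x ^ q + y ^ q
  frobenius-q x y = frobenius m x y

  relTr : F → F
  relTr y = y ^ q + y

  relTr-Fq : ∀ y → (relTr y) ^ q ≡ relTr y
  relTr-Fq y = trans (frobenius-q (y ^ q) y) (trans (cong (_+ y ^ q) (^q-involutive y)) (+-comm y _))

  relTr-scale : ∀ {t} y → t ^ q ≡ t → relTr (t * y) ≡ t * relTr y
  relTr-scale {t} y t∈Fq = trans (cong (_+ t * y) (trans (^-distribʳ-* t y q) (cong (_* y ^ q) t∈Fq)))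
    (sym (distribˡ t (y ^ q) y))

  trace-relTr : ∀ y → trace (2 ℕ.* m) y ≡ trace m (relTr y)
  trace-relTr y = begin
    trace (2 ℕ.* m) y ≡⟨ cong (λ n → trace n y) (cong (m ℕ.+_) (ℕP.+-identityʳ m)) ⟩
    trace (m ℕ.+ m) y ≡⟨ trace-split m m y ⟩
    trace m (y ^ q) + trace m y ≡⟨ sym (trace-+ m (y ^ q) y) ⟩
    trace m (relTr y) ∎

  Tr-0∨1 : ∀ y → trace (2 ℕ.* m) y ≡ 0# ⊎ trace (2 ℕ.* m) y ≡ 1#
  Tr-0∨1 y with trace-0∨1 m (relTr y) (relTr-Fq y)
  ... | inj₁ p = inj₁ (trans (trace-relTr y) p)
  ... | inj₂ p = inj₂ (trans (trace-relTr y) p)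

  χ-+ : ∀ x y → χ (x + y) ≡ χ x ℤ.* χ y
  χ-+ x y = trans (cong sgn (trans (cong bit (trace-+ (2 ℕ.* m) x y)) (bit-+ (Tr-0∨1 x) (Tr-0∨1 y))))
    (sgn-xor (Tr x) (Tr y))

  χq-+ : ∀ x y → x ^ q ≡ x → y ^ q ≡ y → χq (x + y) ≡ χq x ℤ.* χq y
  χq-+ x y x∈Fq y∈Fq = trans (cong sgn (trans (cong bit (trace-+ m x y)) (bit-+ (trace-0∨1 m x x∈Fq) (trace-0∨1 m y y∈Fq))))
    (sgn-xor (bit (trace m x)) (bit (trace m y)))

  χ≡χq∘relTr : ∀ y → χ y ≡ χq (relTr y)
  χ≡χq∘relTr y = cong (λ z → sgn (bit z)) (trace-relTr y)

  χ-0 : χ 0# ≡ ℤ.+ 1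
  χ-0 = cong sgn (trans (cong bit (trace-0 (2 ℕ.* m))) bit-0)

  χq-0 : χq 0# ≡ ℤ.+ 1
  χq-0 = cong sgn (trans (cong bit (trace-0 m)) bit-0)

  q-2 : ℕ
  q-2 = 2 ℕ.+ 2 ℕ.* s

  -- Σ_(x ∈ F_q^*) Tr₁ᵐ(x) x^(q-2): it equals 1, but would vanish if Tr₁ᵐ were identically 0 on F_q.
  traceMoment : F
  traceMoment = sumF q-1 (λ e → trace m (β ^ e) * (β ^ e) ^ q-2)

  γ : ℕ → F
  γ i = β ^ (2 ℕ.^ i ℕ.+ q-2)

  γ^q-1 : ∀ i → γ i ^ q-1 ≡ 1#
  γ^q-1 i = trans (^-comm β (2 ℕ.^ i ℕ.+ q-2) q-1) (trans (cong (_^ (2 ℕ.^ i ℕ.+ q-2)) β^q-1) (1^ (2 ℕ.^ i ℕ.+ q-2)))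

  γ≢1 : ∀ i → 0 < i → i < m → γ i ≢ 1#
  γ≢1 i 0<i i<m γi≡1 = β^a≢1 (2 ℕ.^ i ℕ.∸ 1) 0<2^i∸1 2^i∸1<q-1 (begin
      β ^ (2 ℕ.^ i ℕ.∸ 1)                        ≡⟨ sym (*-identityʳ _) ⟩
      β ^ (2 ℕ.^ i ℕ.∸ 1) * 1#                   ≡⟨ cong (β ^ (2 ℕ.^ i ℕ.∸ 1) *_) (sym β^q-1) ⟩
      β ^ (2 ℕ.^ i ℕ.∸ 1) * β ^ q-1              ≡⟨ sym (^-distribˡ-+-* β (2 ℕ.^ i ℕ.∸ 1) q-1) ⟩
      β ^ (2 ℕ.^ i ℕ.∸ 1 ℕ.+ q-1)                ≡⟨ cong (β ^_) exponent ⟩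
      γ i                                        ≡⟨ γi≡1 ⟩
      1#                                         ∎)
    where
    2≤2^i : 2 ≤ 2 ℕ.^ i
    2≤2^i = ℕP.^-monoʳ-≤ 2 0<i
    0<2^i∸1 : 0 < 2 ℕ.^ i ℕ.∸ 1
    0<2^i∸1 = ℕP.m<n⇒0<n∸m 2≤2^i
    2^i∸1<q-1 : 2 ℕ.^ i ℕ.∸ 1 < q-1
    2^i∸1<q-1 = ℕP.≤-<-trans (ℕP.∸-monoˡ-≤ 1 (ℕ.s≤s⁻¹ (subst (2 ℕ.^ i <_) q≡4+2s (ℕP.^-monoʳ-< 2 (s≤s (s≤s z≤n)) i<m))))
                  (ℕP.n<1+n _)
    exponent : 2 ℕ.^ i ℕ.∸ 1 ℕ.+ q-1 ≡ 2 ℕ.^ i ℕ.+ q-2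
    exponent = trans (ℕP.+-suc (2 ℕ.^ i ℕ.∸ 1) q-2)
      (cong (ℕ._+ q-2) (ℕP.m+[n∸m]≡n {1} {2 ℕ.^ i} (ℕP.≤-trans (s≤s z≤n) 2≤2^i)))

  traceMoment-swap : traceMoment ≡ sumF m (λ i → sumF q-1 (γ i ^_))
  traceMoment-swap = trans (sumF-cong q-1 (λ e _ → expand e)) (sumF-swap q-1 m (λ e i → γ i ^ e))
    where
    expand : ∀ e → trace m (β ^ e) * (β ^ e) ^ q-2 ≡ sumF m (λ i → γ i ^ e)
    expand e = trans (cong (_* (β ^ e) ^ q-2) (trace-sumF m (β ^ e)))
      (trans (sumF-*ʳ m (λ i → (β ^ e) ^ (2 ℕ.^ i)) ((β ^ e) ^ q-2))
        (sumF-cong m (λ i _ → trans (sym (^-distribˡ-+-* (β ^ e) (2 ℕ.^ i) q-2)) (^-comm β e (2 ℕ.^ i ℕ.+ q-2)))))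

  -- Only the geometric sum of γ 0 = 1 survives, and it has an odd number q - 1 of terms.
  traceMoment≡1 : traceMoment ≡ 1#
  traceMoment≡1 = trans traceMoment-swap (sum-γ m refl)
    where
    sum-γ : ∀ n → n ≡ m → sumF n (λ i → sumF q-1 (γ i ^_)) ≡ 1#
    sum-γ zero 0≡m = ⊥-elim (m≢0 (sym 0≡m))
    sum-γ (suc n) 1+n≡m = trans
      (sumF-head n _ (λ i 0<i i<1+n → geometric-sum≡0 (γ i) q-1 (γ^q-1 i) (γ≢1 i 0<i (subst (i <_) 1+n≡m i<1+n))))
      (trans (sumF-cong q-1 (λ e _ → trans (cong (_^ e) β^q-1) (1^ e))) (sumF-1-odd s))

  TraceOne : F → Set
  TraceOne w = w ^ q ≡ w × trace m w ≡ 1#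

  traceMoment≡0 : (∀ w → ¬ TraceOne w) → traceMoment ≡ 0#
  traceMoment≡0 ∄w = trans (sumF-cong q-1 (λ e _ → term≡0 e (trace-0∨1 m (β ^ e) (β^-Fq e)))) (sumF-0 q-1)
    where
    term≡0 : ∀ e → trace m (β ^ e) ≡ 0# ⊎ trace m (β ^ e) ≡ 1# → trace m (β ^ e) * (β ^ e) ^ q-2 ≡ 0#
    term≡0 e (inj₁ tr≡0) = trans (cong (_* (β ^ e) ^ q-2) tr≡0) (zeroˡ _)
    term≡0 e (inj₂ tr≡1) = ⊥-elim (∄w (β ^ e) (β^-Fq e , tr≡1))

  ∃TraceOne : ∃ TraceOne
  ∃TraceOne with any? (λ w → ((w ^ q) ≟ w) ×-dec (trace m w ≟ 1#)) elems
  ... | yes p = let (w , _ , one) = find p in w , one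
  ... | no ¬p = ⊥-elim (0≢1 (trans (sym (traceMoment≡0 (λ w one → ¬p (lose (complete w) one)))) traceMoment≡1))

  Fq-* : ∀ {x y} → x ^ q ≡ x → y ^ q ≡ y → (x * y) ^ q ≡ x * y
  Fq-* {x} {y} x∈Fq y∈Fq = trans (^-distribʳ-* x y q) (cong₂ _*_ x∈Fq y∈Fq)

  Fq-+ : ∀ {x y} → x ^ q ≡ x → y ^ q ≡ y → (x + y) ^ q ≡ x + y
  Fq-+ {x} {y} x∈Fq y∈Fq = trans (frobenius-q x y) (cong₂ _+_ x∈Fq y∈Fq)

  Fq-⁻¹ : ∀ {x} → x ^ q ≡ x → (x ⁻¹) ^ q ≡ x ⁻¹
  Fq-⁻¹ {x} x∈Fq = trans (⁻¹-^ x q) (cong _⁻¹ x∈Fq)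

  sumFq-cong : ∀ {g h : F → ℤ} → (∀ t → t ^ q ≡ t → g t ≡ h t) → sumFq g ≡ sumFq h
  sumFq-cong g≗h = sumMap-cong elems (λ t → []·-cong ((t ^ q) ≟ t) (g≗h t))

  sumFq-shift : ∀ {t₀} (h : F → ℤ) → t₀ ^ q ≡ t₀ → sumFq (λ t → h (t + t₀)) ≡ sumFq h
  sumFq-shift {t₀} h t₀∈Fq = trans (sumMap-cong elems (λ x → cong (λ b → [ b ]· h (x + t₀)) (sym (shift-Fq x))))
      (sum-elems-reindex (λ t → [ does ((t ^ q) ≟ t) ]· h t) (_+ t₀) (_+ t₀) (λ t → x+y+y≡x t t₀))
    where
    shift-Fq : ∀ x → does (((x + t₀) ^ q) ≟ (x + t₀)) ≡ does ((x ^ q) ≟ x)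
    shift-Fq x = does-⇔ (((x + t₀) ^ q) ≟ (x + t₀)) ((x ^ q) ≟ x)
      (λ e → +-cancelʳ t₀ (trans (sym (trans (frobenius-q x t₀) (cong (x ^ q +_) t₀∈Fq))) e))
      (λ x∈Fq → Fq-+ x∈Fq t₀∈Fq)

  sumFq-neg : (h : F → ℤ) → sumFq (λ t → ℤ.- h t) ≡ ℤ.- sumFq h
  sumFq-neg h = trans (sumMap-cong elems (λ t → []·-neg (does ((t ^ q) ≟ t)) (h t))) (sumMap-neg _ elems)
    where
    []·-neg : ∀ b z → [ b ]· (ℤ.- z) ≡ ℤ.- ([ b ]· z)
    []·-neg true z = refl
    []·-neg false z = refl

  w₁ : F
  w₁ = proj₁ ∃TraceOne

  w₁-Fq : w₁ ^ q ≡ w₁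
  w₁-Fq = proj₁ (proj₂ ∃TraceOne)

  χq-w₁ : χq w₁ ≡ ℤ.-[1+ 0 ]
  χq-w₁ = cong sgn (trans (cong bit (proj₂ (proj₂ ∃TraceOne))) bit-1)

  -- Translating by t₀ = w₁ / c multiplies every term by χq w₁ = -1.
  sumFq-χq≡0 : ∀ {c} → c ^ q ≡ c → c ≢ 0# → sumFq (λ t → χq (c * t)) ≡ ℤ.+ 0
  sumFq-χq≡0 {c} c∈Fq c≢0 = ≡-neg⇒0 _ (begin
      sumFq (λ t → χq (c * t))            ≡⟨ sym (sumFq-shift (λ t → χq (c * t)) t₀∈Fq) ⟩
      sumFq (λ t → χq (c * (t + t₀)))     ≡⟨ sumFq-cong flip-sign ⟩
      sumFq (λ t → ℤ.- χq (c * t))        ≡⟨ sumFq-neg _ ⟩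
      ℤ.- sumFq (λ t → χq (c * t))        ∎)
    where
    t₀ : F
    t₀ = w₁ * c ⁻¹
    t₀∈Fq : t₀ ^ q ≡ t₀
    t₀∈Fq = Fq-* w₁-Fq (Fq-⁻¹ c∈Fq)
    c*t₀≡w₁ : c * t₀ ≡ w₁
    c*t₀≡w₁ = trans (solve 3 (λ a b c → (a ⊗ (b ⊗ c)) ⊜ (b ⊗ (a ⊗ c))) refl c w₁ (c ⁻¹))
      (trans (cong (w₁ *_) (inverseʳ c c≢0)) (*-identityʳ w₁))
    flip-sign : ∀ t → t ^ q ≡ t → χq (c * (t + t₀)) ≡ ℤ.- χq (c * t)
    flip-sign t t∈Fq = begin
      χq (c * (t + t₀))            ≡⟨ cong χq (trans (distribˡ c t t₀) (cong (c * t +_) c*t₀≡w₁)) ⟩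
      χq (c * t + w₁)              ≡⟨ χq-+ (c * t) w₁ (Fq-* c∈Fq t∈Fq) w₁-Fq ⟩
      χq (c * t) ℤ.* χq w₁         ≡⟨ cong (χq (c * t) ℤ.*_) χq-w₁ ⟩
      χq (c * t) ℤ.* ℤ.-[1+ 0 ]    ≡⟨ z*-1≡-z _ ⟩
      ℤ.- χq (c * t)               ∎

  sumFq-χq : ∀ {c} → c ^ q ≡ c → sumFq (λ t → χq (c * t)) ≡ [ does (c ≟ 0#) ]· ℤ.+ q
  sumFq-χq {c} c∈Fq with c ≟ 0#
  ... | yes refl = trans (sumFq-cong (λ t _ → trans (cong χq (zeroˡ t)) χq-0)) sumFq-1
  ... | no c≢0 = sumFq-χq≡0 c∈Fq c≢0

  v≢1 : v ≢ 1#
  v≢1 v≡1 = v^a≢1 1 (s≤s z≤n) (s≤s (s≤s z≤n)) (trans (^-identityʳ v) v≡1)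

  v^q≡v⁻¹ : v ^ q ≡ v ⁻¹
  v^q≡v⁻¹ = ^q≡⁻¹ v^q+1

  1+v≢0 : 1# + v ≢ 0#
  1+v≢0 1+v≡0 = v≢1 (sym (x+y≡0⇒x≡y 1+v≡0))

  [1+v]⁻¹ : F
  [1+v]⁻¹ = (1# + v) ⁻¹

  v*[1+v]⁻¹+[1+v]⁻¹≡1 : v * [1+v]⁻¹ + [1+v]⁻¹ ≡ 1#
  v*[1+v]⁻¹+[1+v]⁻¹≡1 = begin
    v * [1+v]⁻¹ + [1+v]⁻¹         ≡⟨ cong (v * [1+v]⁻¹ +_) (sym (*-identityˡ [1+v]⁻¹)) ⟩
    v * [1+v]⁻¹ + 1# * [1+v]⁻¹    ≡⟨ sym (distribʳ [1+v]⁻¹ v 1#) ⟩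
    (v + 1#) * [1+v]⁻¹            ≡⟨ cong (_* [1+v]⁻¹) (+-comm v 1#) ⟩
    (1# + v) * [1+v]⁻¹            ≡⟨ inverseʳ (1# + v) 1+v≢0 ⟩
    1#                            ∎

  -- 1/(1 + v) + 1/(1 + v⁻¹) = 1, and v^q = v⁻¹.
  relTr-[1+v]⁻¹ : relTr [1+v]⁻¹ ≡ 1#
  relTr-[1+v]⁻¹ = begin
    [1+v]⁻¹ ^ q + [1+v]⁻¹      ≡⟨ cong (_+ [1+v]⁻¹) (trans (⁻¹-^ (1# + v) q)
                                    (cong _⁻¹ (trans (frobenius-q 1# v) (cong₂ _+_ (1^ q) v^q≡v⁻¹)))) ⟩
    (1# + v ⁻¹) ⁻¹ + [1+v]⁻¹   ≡⟨ cong (_+ [1+v]⁻¹) (sym (x*y≡1⇒y≡x⁻¹ inverse)) ⟩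
    v * [1+v]⁻¹ + [1+v]⁻¹      ≡⟨ v*[1+v]⁻¹+[1+v]⁻¹≡1 ⟩
    1#                         ∎
    where
    inverse : (1# + v ⁻¹) * (v * [1+v]⁻¹) ≡ 1#
    inverse = begin
      (1# + v ⁻¹) * (v * [1+v]⁻¹)               ≡⟨ distribʳ (v * [1+v]⁻¹) 1# (v ⁻¹) ⟩
      1# * (v * [1+v]⁻¹) + v ⁻¹ * (v * [1+v]⁻¹) ≡⟨ cong₂ _+_ (*-identityˡ _) (trans (sym (*-assoc _ _ _))
                                                     (trans (cong (_* [1+v]⁻¹) (inverseˡ v v≢0)) (*-identityˡ _))) ⟩
      v * [1+v]⁻¹ + [1+v]⁻¹                     ≡⟨ v*[1+v]⁻¹+[1+v]⁻¹≡1 ⟩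
      1#                                        ∎

  y₁ : F
  y₁ = w₁ * [1+v]⁻¹

  χ-y₁ : χ y₁ ≡ ℤ.-[1+ 0 ]
  χ-y₁ = trans (χ≡χq∘relTr y₁) (trans (cong χq relTr-y₁) χq-w₁)
    where
    relTr-y₁ : relTr y₁ ≡ w₁
    relTr-y₁ = trans (relTr-scale [1+v]⁻¹ w₁-Fq) (trans (cong (w₁ *_) relTr-[1+v]⁻¹) (*-identityʳ w₁))

  -- The same translation argument, now with χ y₁ = -1.
  sum-χ≡0 : ∀ {a} → a ≢ 0# → sumMap (λ y → χ (a * y)) elems ≡ ℤ.+ 0
  sum-χ≡0 {a} a≢0 = ≡-neg⇒0 _ (begin
      sumMap (λ y → χ (a * y)) elems          ≡⟨ sym (sum-elems-reindex (λ y → χ (a * y)) (_+ t₀) (_+ t₀) (λ t → x+y+y≡x t t₀)) ⟩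
      sumMap (λ y → χ (a * (y + t₀))) elems   ≡⟨ sumMap-cong elems flip-sign ⟩
      sumMap (λ y → ℤ.- χ (a * y)) elems      ≡⟨ sumMap-neg _ elems ⟩
      ℤ.- sumMap (λ y → χ (a * y)) elems      ∎)
    where
    t₀ : F
    t₀ = a ⁻¹ * y₁
    a*t₀≡y₁ : a * t₀ ≡ y₁
    a*t₀≡y₁ = trans (sym (*-assoc a (a ⁻¹) y₁)) (trans (cong (_* y₁) (inverseʳ a a≢0)) (*-identityˡ y₁))
    flip-sign : ∀ y → χ (a * (y + t₀)) ≡ ℤ.- χ (a * y)
    flip-sign y = begin
      χ (a * (y + t₀))          ≡⟨ cong χ (trans (distribˡ a y t₀) (cong (a * y +_) a*t₀≡y₁)) ⟩
      χ (a * y + y₁)            ≡⟨ χ-+ (a * y) y₁ ⟩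
      χ (a * y) ℤ.* χ y₁        ≡⟨ cong (χ (a * y) ℤ.*_) χ-y₁ ⟩
      χ (a * y) ℤ.* ℤ.-[1+ 0 ]  ≡⟨ z*-1≡-z _ ⟩
      ℤ.- χ (a * y)             ∎

  -- The Kloosterman identity: Σ_(z ∈ μ_(q+1)) χ (a z) = 1 - K_m(a^(q+1)) for a ≠ 0.

  q+1≡1+q : q+1 ≡ suc q
  q+1≡1+q = sym (cong suc q≡4+2s)

  x^[q+1]≡x*x^q : ∀ x → x ^ q+1 ≡ x * x ^ q
  x^[q+1]≡x*x^q x = cong (x ^_) q+1≡1+q

  norm-Fq : ∀ y → (y ^ q+1) ^ q ≡ y ^ q+1
  norm-Fq y with y ≟ 0#
  ... | yes refl = trans (cong (_^ q) (zeroˡ _)) (trans 0^q≡0 (sym (zeroˡ _)))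
  ... | no y≢0 = ^[q-1]≡1⇒Fq (trans (sym (^-* y q+1 q-1)) (trans (cong (y ^_) (ℕP.*-comm q+1 q-1)) (x^M≡1 y≢0)))

  χ-Fq : ∀ {w} → w ^ q ≡ w → χ w ≡ ℤ.+ 1
  χ-Fq {w} w∈Fq = trans (χ≡χq∘relTr w) (trans (cong χq (trans (cong (_+ w) w∈Fq) (x+x≡0 w))) χq-0)

  sumFq-⁻¹ : (h : F → ℤ) → sumFq (λ x → h (x ⁻¹)) ≡ sumFq h
  sumFq-⁻¹ h = trans (sumMap-cong elems (λ x → cong (λ b → [ b ]· h (x ⁻¹)) (sym (inverse-Fq x))))
      (sum-elems-reindex (λ t → [ does ((t ^ q) ≟ t) ]· h t) _⁻¹ _⁻¹ ⁻¹-involutive)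
    where
    inverse-Fq : ∀ x → does (((x ⁻¹) ^ q) ≟ (x ⁻¹)) ≡ does ((x ^ q) ≟ x)
    inverse-Fq x = does-⇔ (((x ⁻¹) ^ q) ≟ (x ⁻¹)) ((x ^ q) ≟ x)
      (λ x⁻¹∈Fq → trans (sym (⁻¹-involutive (x ^ q)))
                    (trans (cong _⁻¹ (sym (⁻¹-^ x q))) (trans (cong _⁻¹ x⁻¹∈Fq) (⁻¹-involutive x))))
      Fq-⁻¹

  -- The norm y ↦ y^(q+1) hits 0 once and every element of F_q^* exactly q + 1 times.
  sum-χq-norm : ∀ {x} → x ^ q ≡ x → x ≢ 0# → sumMap (λ y → χq (x * y ^ q+1)) elems ≡ ℤ.- (ℤ.+ q)
  sum-χq-norm {x} x∈Fq x≢0 = begin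
    sumMap (λ y → χq (x * y ^ q+1)) elems
      ≡⟨ sum-norm (λ w → χq (x * w)) ⟩
    χq (x * 0#) ℤ.+ ℤ.+ q+1 ℤ.* sumBelow q-1 (λ t → χq (x * β ^ t))
      ≡⟨ cong₂ (λ a b → a ℤ.+ ℤ.+ q+1 ℤ.* b) χq[x*0]≡1 (trans (sumBelow-β^ (λ t → χq (x * t)))
           (cong₂ ℤ._-_ (sumFq-χq≡0 x∈Fq x≢0) χq[x*0]≡1)) ⟩
    ℤ.+ 1 ℤ.+ ℤ.+ q+1 ℤ.* (ℤ.+ 0 ℤ.- ℤ.+ 1)
      ≡⟨ cong (λ n → ℤ.+ 1 ℤ.+ ℤ.+ n ℤ.* (ℤ.+ 0 ℤ.- ℤ.+ 1)) q+1≡1+q ⟩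
    ℤ.+ 1 ℤ.+ (ℤ.+ 1 ℤ.+ ℤ.+ q) ℤ.* (ℤ.+ 0 ℤ.- ℤ.+ 1)
      ≡⟨ ℤS.solve 1 (λ Q → ℤS.con (ℤ.+ 1) ℤS.:+ (ℤS.con (ℤ.+ 1) ℤS.:+ Q) ℤS.:* (ℤS.con (ℤ.+ 0) ℤS.:- ℤS.con (ℤ.+ 1))
                              ℤS.:= ℤS.:- Q) refl (ℤ.+ q) ⟩
    ℤ.- (ℤ.+ q) ∎
    where
    χq[x*0]≡1 : χq (x * 0#) ≡ ℤ.+ 1
    χq[x*0]≡1 = trans (cong χq (zeroʳ x)) χq-0

  module _ (a : F) (a≢0 : a ≢ 0#) where

    N[a] : F
    N[a] = a ^ q+1

    N[a]-Fq : N[a] ^ q ≡ N[a]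
    N[a]-Fq = norm-Fq a

    twistedSum : F → ℤ
    twistedSum x = sumMap (λ y → χ (a * y) ℤ.* χq (x * y ^ q+1)) elems

    twistedSum-0 : twistedSum 0# ≡ ℤ.+ 0
    twistedSum-0 = trans (sumMap-cong elems χq-0-term) (sum-χ≡0 a≢0)
      where
      χq-0-term : ∀ y → χ (a * y) ℤ.* χq (0# * y ^ q+1) ≡ χ (a * y)
      χq-0-term y = trans (cong (λ z → χ (a * y) ℤ.* χq z) (zeroˡ _))
        (trans (cong (χ (a * y) ℤ.*_) χq-0) (ℤP.*-identityʳ _))

    module _ {x : F} (x∈Fq : x ^ q ≡ x) (x≢0 : x ≢ 0#) where

      private
        c : F
        c = (a * x ⁻¹) ^ q

        R : F
        R = N[a] * x ⁻¹

        R-Fq : R ^ q ≡ R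
        R-Fq = Fq-* N[a]-Fq (Fq-⁻¹ x∈Fq)

        x*[z*x⁻¹]≡z : ∀ z → x * (z * x ⁻¹) ≡ z
        x*[z*x⁻¹]≡z z = trans (solve 3 (λ x z i → (x ⊗ (z ⊗ i)) ⊜ (z ⊗ (x ⊗ i))) refl x z (x ⁻¹))
          (trans (cong (z *_) (inverseʳ x x≢0)) (*-identityʳ z))

        c≡a^q*x⁻¹ : c ≡ a ^ q * x ⁻¹
        c≡a^q*x⁻¹ = trans (^-distribʳ-* a (x ⁻¹) q) (cong (a ^ q *_) (Fq-⁻¹ x∈Fq))

        x*c^q≡a : x * c ^ q ≡ a
        x*c^q≡a = trans (cong (x *_) (^q-involutive (a * x ⁻¹))) (x*[z*x⁻¹]≡z a)

        x*c≡a^q : x * c ≡ a ^ q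
        x*c≡a^q = trans (cong (x *_) c≡a^q*x⁻¹) (x*[z*x⁻¹]≡z (a ^ q))

        a*c≡R : a * c ≡ R
        a*c≡R = trans (cong (a *_) c≡a^q*x⁻¹)
          (trans (sym (*-assoc a (a ^ q) (x ⁻¹))) (cong (_* x ⁻¹) (sym (x^[q+1]≡x*x^q a))))

        x*c*c^q≡R : (x * c) * c ^ q ≡ R
        x*c*c^q≡R = trans (cong₂ _*_ x*c≡a^q (^q-involutive (a * x ⁻¹)))
          (trans (sym (*-assoc (a ^ q) a (x ⁻¹)))
            (cong (_* x ⁻¹) (trans (*-comm (a ^ q) a) (sym (x^[q+1]≡x*x^q a)))))

        -- Completing the norm: the shift by c turns the cross terms into the relative trace of a y.
        norm-shift : ∀ y → x * (y + c) ^ q+1 ≡ (x * y ^ q+1 + relTr (a * y)) + R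
        norm-shift y = begin
          x * (y + c) ^ q+1
            ≡⟨ cong (x *_) (trans (x^[q+1]≡x*x^q (y + c)) (cong ((y + c) *_) (frobenius-q y c))) ⟩
          x * ((y + c) * (y ^ q + c ^ q))
            ≡⟨ expand x y c (y ^ q) (c ^ q) ⟩
          (x * (y * y ^ q) + ((x * c ^ q) * y + (x * c) * y ^ q)) + (x * c) * c ^ q
            ≡⟨ cong₂ (λ n t → (x * n + t) + (x * c) * c ^ q) (sym (x^[q+1]≡x*x^q y)) cross-terms ⟩
          (x * y ^ q+1 + relTr (a * y)) + (x * c) * c ^ q
            ≡⟨ cong ((x * y ^ q+1 + relTr (a * y)) +_) x*c*c^q≡R ⟩
          (x * y ^ q+1 + relTr (a * y)) + R ∎
          where
          expand : ∀ x y c y′ c′ → x * ((y + c) * (y′ + c′))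
                                   ≡ (x * (y * y′) + ((x * c′) * y + (x * c) * y′)) + (x * c) * c′
          expand x y c y′ c′ = begin
            x * ((y + c) * (y′ + c′))
              ≡⟨ cong (x *_) (solve 4 (λ y c y′ c′ → ((y ⊕ c) ⊗ (y′ ⊕ c′)) ⊜ ((y ⊗ y′ ⊕ y ⊗ c′) ⊕ (c ⊗ y′ ⊕ c ⊗ c′))) refl y c y′ c′) ⟩
            x * ((y * y′ + y * c′) + (c * y′ + c * c′))
              ≡⟨ trans (distribˡ x _ _) (cong₂ _+_ (distribˡ x _ _) (distribˡ x _ _)) ⟩
            (x * (y * y′) + x * (y * c′)) + (x * (c * y′) + x * (c * c′))
              ≡⟨ cong₂ (λ u w → (x * (y * y′) + u) + w)
                   (solve 3 (λ x y c → (x ⊗ (y ⊗ c)) ⊜ ((x ⊗ c) ⊗ y)) refl x y c′)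
                   (cong₂ _+_ (sym (*-assoc x c y′)) (sym (*-assoc x c c′))) ⟩
            (x * (y * y′) + (x * c′) * y) + ((x * c) * y′ + (x * c) * c′)
              ≡⟨ solve 4 (λ a b c d → ((a ⊕ b) ⊕ (c ⊕ d)) ⊜ ((a ⊕ (b ⊕ c)) ⊕ d)) refl _ _ _ _ ⟩
            (x * (y * y′) + ((x * c′) * y + (x * c) * y′)) + (x * c) * c′ ∎
          cross-terms : (x * c ^ q) * y + (x * c) * y ^ q ≡ relTr (a * y)
          cross-terms = trans (cong₂ (λ u w → u * y + w * y ^ q) x*c^q≡a x*c≡a^q)
            (trans (cong (a * y +_) (sym (^-distribʳ-* a y q))) (+-comm (a * y) _))

        shifted-term : ∀ y → χ (a * (y + c)) ℤ.* χq (x * (y + c) ^ q+1) ≡ χq R ℤ.* χq (x * y ^ q+1)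
        shifted-term y = begin
          χ (a * (y + c)) ℤ.* χq (x * (y + c) ^ q+1)
            ≡⟨ cong₂ ℤ._*_ χ-part χq-part ⟩
          (χ (a * y) ℤ.* ℤ.+ 1) ℤ.* ((χq (x * y ^ q+1) ℤ.* χ (a * y)) ℤ.* χq R)
            ≡⟨ ℤS.solve 3 (λ p n r → (p ℤS.:* ℤS.con (ℤ.+ 1)) ℤS.:* ((n ℤS.:* p) ℤS.:* r) ℤS.:= (r ℤS.:* n) ℤS.:* (p ℤS.:* p))
                 refl (χ (a * y)) (χq (x * y ^ q+1)) (χq R) ⟩
          (χq R ℤ.* χq (x * y ^ q+1)) ℤ.* (χ (a * y) ℤ.* χ (a * y))
            ≡⟨ cong ((χq R ℤ.* χq (x * y ^ q+1)) ℤ.*_) (sgn² (Tr (a * y))) ⟩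
          (χq R ℤ.* χq (x * y ^ q+1)) ℤ.* ℤ.+ 1
            ≡⟨ ℤP.*-identityʳ _ ⟩
          χq R ℤ.* χq (x * y ^ q+1) ∎
          where
          norm∈Fq : (x * y ^ q+1) ^ q ≡ x * y ^ q+1
          norm∈Fq = Fq-* x∈Fq (norm-Fq y)
          χ-part : χ (a * (y + c)) ≡ χ (a * y) ℤ.* ℤ.+ 1
          χ-part = trans (cong χ (trans (distribˡ a y c) (cong (a * y +_) a*c≡R)))
            (trans (χ-+ (a * y) R) (cong (χ (a * y) ℤ.*_) (χ-Fq R-Fq)))
          χq-part : χq (x * (y + c) ^ q+1) ≡ (χq (x * y ^ q+1) ℤ.* χ (a * y)) ℤ.* χq R
          χq-part = trans (cong χq (norm-shift y))
            (trans (χq-+ _ R (Fq-+ norm∈Fq (relTr-Fq (a * y))) R-Fq)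
              (cong (ℤ._* χq R) (trans (χq-+ (x * y ^ q+1) (relTr (a * y)) norm∈Fq (relTr-Fq (a * y)))
                (cong (χq (x * y ^ q+1) ℤ.*_) (sym (χ≡χq∘relTr (a * y)))))))

      twistedSum≡ : twistedSum x ≡ χq (N[a] * x ⁻¹) ℤ.* ℤ.- (ℤ.+ q)
      twistedSum≡ = begin
        twistedSum x
          ≡⟨ sym (sum-elems-reindex (λ y → χ (a * y) ℤ.* χq (x * y ^ q+1)) (_+ c) (_+ c) (λ y → x+y+y≡x y c)) ⟩
        sumMap (λ y → χ (a * (y + c)) ℤ.* χq (x * (y + c) ^ q+1)) elems
          ≡⟨ sumMap-cong elems shifted-term ⟩
        sumMap (λ y → χq R ℤ.* χq (x * y ^ q+1)) elems
          ≡⟨ sumMap-* (χq R) (λ y → χq (x * y ^ q+1)) elems ⟩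
        χq R ℤ.* sumMap (λ y → χq (x * y ^ q+1)) elems
          ≡⟨ cong (χq R ℤ.*_) (sum-χq-norm x∈Fq x≢0) ⟩
        χq R ℤ.* ℤ.- (ℤ.+ q) ∎

    kloostermanTerm : F → ℤ
    kloostermanTerm x = χq (x + N[a] * x ⁻¹)

    kloosterman* : ℤ
    kloosterman* = sumBelow q-1 (λ t → kloostermanTerm (β ^ t))

    x^[q-2]≡x⁻¹ : ∀ x → x ^ q ≡ x → x ^ (q ℕ.∸ 2) ≡ x ⁻¹
    x^[q-2]≡x⁻¹ x x∈Fq with x ≟ 0#
    ... | yes refl = trans (cong (0# ^_) (cong (ℕ._∸ 2) q≡4+2s)) (trans (zeroˡ _) (sym inv-0))
    ... | no x≢0 = trans (cong (x ^_) (cong (ℕ._∸ 2) q≡4+2s)) (x*y≡1⇒y≡x⁻¹ (Fq*⇒^[q-1]≡1 x≢0 x∈Fq))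

    kloosterman≡1+kloosterman* : kloosterman 𝔽 m N[a] ≡ ℤ.+ 1 ℤ.+ kloosterman*
    kloosterman≡1+kloosterman* = begin
      kloosterman 𝔽 m N[a]
        ≡⟨ sumMap-filter (λ x → (x ^ q) ≟ x) (λ x → χq (N[a] * x + x ^ (q ℕ.∸ 2))) elems ⟩
      sumFq (λ x → χq (N[a] * x + x ^ (q ℕ.∸ 2)))
        ≡⟨ sumFq-cong (λ x x∈Fq → cong χq (trans (cong (N[a] * x +_) (x^[q-2]≡x⁻¹ x x∈Fq)) (swap x))) ⟩
      sumFq (λ x → kloostermanTerm (x ⁻¹))
        ≡⟨ sumFq-⁻¹ kloostermanTerm ⟩
      sumFq kloostermanTerm
        ≡⟨ sumFq-β^ kloostermanTerm ⟩
      kloostermanTerm 0# ℤ.+ kloosterman*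
        ≡⟨ cong (ℤ._+ kloosterman*) (trans (cong χq (trans (cong (λ z → 0# + N[a] * z) inv-0) (trans (+-identityˡ _) (zeroʳ N[a])))) χq-0) ⟩
      ℤ.+ 1 ℤ.+ kloosterman* ∎
      where
      swap : ∀ x → N[a] * x + x ⁻¹ ≡ x ⁻¹ + N[a] * x ⁻¹ ⁻¹
      swap x = trans (+-comm _ _) (cong (λ z → x ⁻¹ + N[a] * z) (sym (⁻¹-involutive x)))

    sumμ-χ : ℤ
    sumμ-χ = sumMap (λ y → [ does ((y ^ q+1) ≟ 1#) ]· χ (a * y)) elems

    [norm≡1]·q : ∀ y → [ does ((y ^ q+1) ≟ 1#) ]· ℤ.+ q ≡ sumFq (λ x → χq ((y ^ q+1 + 1#) * x))
    [norm≡1]·q y = sym (trans (sumFq-χq (Fq-+ (norm-Fq y) (1^ q)))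
      (cong (λ b → [ b ]· ℤ.+ q) (does-⇔ ((y ^ q+1 + 1#) ≟ 0#) ((y ^ q+1) ≟ 1#) x+y≡0⇒x≡y x≡y⇒x+y≡0)))

    -- Detect y^(q+1) = 1 by orthogonality of χq on F_q, then swap the two sums.
    q*sumμ-χ : ℤ.+ q ℤ.* sumμ-χ ≡ sumFq (λ x → χq x ℤ.* twistedSum x)
    q*sumμ-χ = begin
      ℤ.+ q ℤ.* sumμ-χ
        ≡⟨ sym (sumMap-* (ℤ.+ q) _ elems) ⟩
      sumMap (λ y → ℤ.+ q ℤ.* ([ [q+1]≡1 y ]· χ (a * y))) elems
        ≡⟨ sumMap-cong elems (λ y → trans (q*[b]·z (does ((y ^ q+1) ≟ 1#)) (χ (a * y))) (cong (χ (a * y) ℤ.*_) ([norm≡1]·q y))) ⟩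
      sumMap (λ y → χ (a * y) ℤ.* sumFq (λ x → χq ((y ^ q+1 + 1#) * x))) elems
        ≡⟨ sumMap-cong elems (λ y → trans (sym (sumMap-* (χ (a * y)) _ elems))
             (sumMap-cong elems (λ x → z*[b]·w (does ((x ^ q) ≟ x)) (χ (a * y)) _))) ⟩
      sumMap (λ y → sumMap (λ x → [ Fq? x ]· (χ (a * y) ℤ.* χq ((y ^ q+1 + 1#) * x))) elems) elems
        ≡⟨ sumMap-swap (λ y x → [ Fq? x ]· (χ (a * y) ℤ.* χq ((y ^ q+1 + 1#) * x))) elems elems ⟩
      sumMap (λ x → sumMap (λ y → [ Fq? x ]· (χ (a * y) ℤ.* χq ((y ^ q+1 + 1#) * x))) elems) elems
        ≡⟨ sumMap-cong elems (λ x → sumMap-[]· (Fq? x) (λ y → χ (a * y) ℤ.* χq ((y ^ q+1 + 1#) * x)) elems) ⟩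
      sumFq (λ x → sumMap (λ y → χ (a * y) ℤ.* χq ((y ^ q+1 + 1#) * x)) elems)
        ≡⟨ sumFq-cong (λ x x∈Fq → trans (sumMap-cong elems (split x x∈Fq)) (sumMap-* (χq x) _ elems)) ⟩
      sumFq (λ x → χq x ℤ.* twistedSum x) ∎
      where
      [q+1]≡1 : F → Bool
      [q+1]≡1 y = does ((y ^ q+1) ≟ 1#)
      Fq? : F → Bool
      Fq? x = does ((x ^ q) ≟ x)
      q*[b]·z : ∀ b z → ℤ.+ q ℤ.* ([ b ]· z) ≡ z ℤ.* ([ b ]· ℤ.+ q)
      q*[b]·z true z = ℤP.*-comm (ℤ.+ q) z
      q*[b]·z false z = trans (ℤP.*-zeroʳ (ℤ.+ q)) (sym (ℤP.*-zeroʳ z))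
      z*[b]·w : ∀ b z w → z ℤ.* ([ b ]· w) ≡ [ b ]· (z ℤ.* w)
      z*[b]·w true z w = refl
      z*[b]·w false z w = ℤP.*-zeroʳ z
      split : ∀ x → x ^ q ≡ x → ∀ y → χ (a * y) ℤ.* χq ((y ^ q+1 + 1#) * x) ≡ χq x ℤ.* (χ (a * y) ℤ.* χq (x * y ^ q+1))
      split x x∈Fq y = trans (cong (λ z → χ (a * y) ℤ.* χq z) (trans (distribʳ x (y ^ q+1) 1#) (cong₂ _+_ (*-comm (y ^ q+1) x) (*-identityˡ x))))
        (trans (cong (χ (a * y) ℤ.*_) (χq-+ (x * y ^ q+1) x (Fq-* x∈Fq (norm-Fq y)) x∈Fq))
          (ℤS.solve 3 (λ p n r → p ℤS.:* (n ℤS.:* r) ℤS.:= r ℤS.:* (p ℤS.:* n)) refl (χ (a * y)) (χq (x * y ^ q+1)) (χq x)))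

    sumFq-χq*twistedSum : sumFq (λ x → χq x ℤ.* twistedSum x) ≡ ℤ.- (ℤ.+ q) ℤ.* kloosterman*
    sumFq-χq*twistedSum = begin
      sumFq (λ x → χq x ℤ.* twistedSum x)
        ≡⟨ sumFq-β^ (λ x → χq x ℤ.* twistedSum x) ⟩
      χq 0# ℤ.* twistedSum 0# ℤ.+ sumBelow q-1 (λ t → χq (β ^ t) ℤ.* twistedSum (β ^ t))
        ≡⟨ cong₂ ℤ._+_ (trans (cong (χq 0# ℤ.*_) twistedSum-0) (ℤP.*-zeroʳ (χq 0#))) (sumBelow-cong q-1 (λ t _ → term t)) ⟩
      ℤ.+ 0 ℤ.+ sumBelow q-1 (λ t → ℤ.- (ℤ.+ q) ℤ.* kloostermanTerm (β ^ t))
        ≡⟨ trans (ℤP.+-identityˡ _) (sumBelow-* q-1 (ℤ.- (ℤ.+ q)) (λ t → kloostermanTerm (β ^ t))) ⟩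
      ℤ.- (ℤ.+ q) ℤ.* kloosterman* ∎
      where
      term : ∀ t → χq (β ^ t) ℤ.* twistedSum (β ^ t) ≡ ℤ.- (ℤ.+ q) ℤ.* kloostermanTerm (β ^ t)
      term t = trans (cong (χq (β ^ t) ℤ.*_) (twistedSum≡ (β^-Fq t) (^-≢0 t β≢0)))
        (trans (ℤS.solve 3 (λ p r n → p ℤS.:* (r ℤS.:* n) ℤS.:= n ℤS.:* (p ℤS.:* r)) refl (χq (β ^ t)) (χq (N[a] * (β ^ t) ⁻¹)) (ℤ.- (ℤ.+ q)))
          (cong (ℤ.- (ℤ.+ q) ℤ.*_) (sym (χq-+ (β ^ t) (N[a] * (β ^ t) ⁻¹) (β^-Fq t) (Fq-* N[a]-Fq (Fq-⁻¹ (β^-Fq t)))))))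

    sumμ-χ≡1-kloosterman : sumBelow q+1 (λ r → χ (a * v ^ r)) ≡ ℤ.+ 1 ℤ.- kloosterman 𝔽 m N[a]
    sumμ-χ≡1-kloosterman = trans (sym (sum-μ (λ y → χ (a * y))))
      (ℤP.*-cancelˡ-≡ (ℤ.+ q) sumμ-χ _ {{q≢0}} (trans q*sumμ-χ (trans sumFq-χq*twistedSum (sym q*[1-K]≡-q*kloosterman*))))
      where
      q≢0 : ℕ.NonZero q
      q≢0 = subst ℕ.NonZero (sym q≡4+2s) _
      q*[1-K]≡-q*kloosterman* : ℤ.+ q ℤ.* (ℤ.+ 1 ℤ.- kloosterman 𝔽 m N[a]) ≡ ℤ.- (ℤ.+ q) ℤ.* kloosterman*
      q*[1-K]≡-q*kloosterman* = trans (cong (λ K → ℤ.+ q ℤ.* (ℤ.+ 1 ℤ.- K)) kloosterman≡1+kloosterman*)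
        (ℤS.solve 2 (λ Q S → Q ℤS.:* (ℤS.con (ℤ.+ 1) ℤS.:- (ℤS.con (ℤ.+ 1) ℤS.:+ S)) ℤS.:= (ℤS.:- Q) ℤS.:* S) refl (ℤ.+ q) kloosterman*)

  v^≡1⇒q+1∣ : ∀ a → v ^ a ≡ 1# → q+1 ∣ a
  v^≡1⇒q+1∣ a v^a≡1 = *-cancelˡ-∣ q-1 (ω^≡1⇒M∣ (q-1 ℕ.* a) (trans (^-* ω q-1 a) v^a≡1))

  v^-injective : ∀ {i j} → i < q+1 → j < q+1 → v ^ i ≡ v ^ j → i ≡ j
  v^-injective {i} {j} i<q+1 j<q+1 v^i≡v^j = ℕP.*-cancelˡ-≡ i j q-1
    (ω^-injective (ℕP.*-monoʳ-< q-1 i<q+1) (ℕP.*-monoʳ-< q-1 j<q+1) (trans (^-* ω q-1 i) (trans v^i≡v^j (sym (^-* ω q-1 j)))))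

  module _ (l : ℕ) (coprime : Coprime q+1 l) where

    private
      ^l-injective-< : ∀ {i j} → i < j → j < q+1 → (v ^ i) ^ l ≢ (v ^ j) ^ l
      ^l-injective-< {i} {j} i<j j<q+1 v^il≡v^jl =
        ℕP.<⇒≱ (ℕP.≤-<-trans (ℕP.m∸n≤m j i) j<q+1) (∣⇒≤ {{ℕ.>-nonZero (ℕP.m<n⇒0<n∸m i<j)}} q+1∣j-i)
        where
        d : ℕ
        d = j ℕ.∸ i
        v^[dl]≡1 : v ^ (d ℕ.* l) ≡ 1#
        v^[dl]≡1 = *-cancelˡ (^-≢0 (i ℕ.* l) v≢0) (begin
          v ^ (i ℕ.* l) * v ^ (d ℕ.* l)   ≡⟨ sym (^-distribˡ-+-* v (i ℕ.* l) (d ℕ.* l)) ⟩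
          v ^ (i ℕ.* l ℕ.+ d ℕ.* l)       ≡⟨ cong (v ^_) (sym (ℕP.*-distribʳ-+ l i d)) ⟩
          v ^ ((i ℕ.+ d) ℕ.* l)           ≡⟨ cong (λ e → v ^ (e ℕ.* l)) (ℕP.m+[n∸m]≡n (ℕP.<⇒≤ i<j)) ⟩
          v ^ (j ℕ.* l)                   ≡⟨ ^-* v j l ⟩
          (v ^ j) ^ l                     ≡⟨ sym v^il≡v^jl ⟩
          (v ^ i) ^ l                     ≡⟨ sym (^-* v i l) ⟩
          v ^ (i ℕ.* l)                   ≡⟨ sym (*-identityʳ _) ⟩
          v ^ (i ℕ.* l) * 1#              ∎)
        q+1∣j-i : q+1 ∣ d
        q+1∣j-i = coprime-divisor coprime (subst (q+1 ∣_) (ℕP.*-comm d l) (v^≡1⇒q+1∣ (d ℕ.* l) v^[dl]≡1))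

    ^l-injective : ∀ {i j} → i < q+1 → j < q+1 → (v ^ i) ^ l ≡ (v ^ j) ^ l → i ≡ j
    ^l-injective {i} {j} i<q+1 j<q+1 e with ℕP.<-cmp i j
    ... | tri< i<j _ _ = ⊥-elim (^l-injective-< i<j j<q+1 e)
    ... | tri≈ _ i≡j _ = i≡j
    ... | tri> _ _ j<i = ⊥-elim (^l-injective-< j<i i<q+1 (sym e))

    sumBelow-v^-^l : (h : F → ℤ) → sumBelow q+1 (λ r → h ((v ^ r) ^ l)) ≡ sumBelow q+1 (λ r → h (v ^ r))
    sumBelow-v^-^l h = begin
      sumBelow q+1 (λ r → h ((v ^ r) ^ l))    ≡⟨ sym (sumMap-applyUpTo h (λ r → (v ^ r) ^ l) q+1) ⟩
      sumMap h (applyUpTo (λ r → (v ^ r) ^ l) q+1)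
        ≡⟨ sym (sumMap-⊆ h (Unique-applyUpTo (λ r → (v ^ r) ^ l) q+1 ^l-injective) ⊆powers
             (ℕP.≤-reflexive (trans (length-applyUpTo (v ^_) q+1) (sym (length-applyUpTo (λ r → (v ^ r) ^ l) q+1))))) ⟩
      sumMap h (applyUpTo (v ^_) q+1)         ≡⟨ sumMap-applyUpTo h (v ^_) q+1 ⟩
      sumBelow q+1 (λ r → h (v ^ r))          ∎
      where
      ⊆powers : applyUpTo (λ r → (v ^ r) ^ l) q+1 ⊆ applyUpTo (v ^_) q+1
      ⊆powers p with ∈-applyUpTo⁻ (λ r → (v ^ r) ^ l) p
      ... | r , _ , refl = subst (_∈ₗ applyUpTo (v ^_) q+1) (trans (sym (^-% q+1 (r ℕ.* l) v^q+1)) (^-* v r l))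
                             (∈-applyUpTo⁺ (v ^_) (m%n<n (r ℕ.* l) q+1))

  sumBelow-χ-β^ : ∀ y → sumBelow q-1 (λ t → χ (β ^ t * y)) ≡ ([ does ((y ^ q) ≟ y) ]· ℤ.+ q) ℤ.- ℤ.+ 1
  sumBelow-χ-β^ y = begin
    sumBelow q-1 (λ t → χ (β ^ t * y))          ≡⟨ sumBelow-β^ (λ t → χ (t * y)) ⟩
    sumFq (λ t → χ (t * y)) ℤ.- χ (0# * y)      ≡⟨ cong₂ ℤ._-_ (trans (sumFq-cong χ≡χq[relTr]) (sumFq-χq (relTr-Fq y)))
                                                     (trans (cong χ (zeroˡ y)) χ-0) ⟩
    ([ does (relTr y ≟ 0#) ]· ℤ.+ q) ℤ.- ℤ.+ 1  ≡⟨ cong (λ b → ([ b ]· ℤ.+ q) ℤ.- ℤ.+ 1)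
                                                     (does-⇔ (relTr y ≟ 0#) ((y ^ q) ≟ y) x+y≡0⇒x≡y x≡y⇒x+y≡0) ⟩
    ([ does ((y ^ q) ≟ y) ]· ℤ.+ q) ℤ.- ℤ.+ 1   ∎
    where
    χ≡χq[relTr] : ∀ t → t ^ q ≡ t → χ (t * y) ≡ χq (relTr y * t)
    χ≡χq[relTr] t t∈Fq = trans (χ≡χq∘relTr (t * y)) (cong χq (trans (relTr-scale y t∈Fq) (*-comm t (relTr y))))

  β^t^[q-1]≡1 : ∀ t → (β ^ t) ^ q-1 ≡ 1#
  β^t^[q-1]≡1 t = trans (^-comm β t q-1) (trans (cong (_^ t) β^q-1) (1^ t))

  -- Functions that vanish at 0 and are constant on the cosets of F_q^*, that is f x = φ (x^(q-1)).
  module Walsh (φ : F → Bool) where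

    fφ : F → Bool
    fφ x = if does (x ≟ 0#) then false else φ (x ^ q-1)

    fφ-0 : fφ 0# ≡ false
    fφ-0 = cong (λ b → if b then false else φ (0# ^ q-1)) (dec-true (0# ≟ 0#) refl)

    fφ-≢0 : ∀ {x} → x ≢ 0# → fφ x ≡ φ (x ^ q-1)
    fφ-≢0 {x} x≢0 = cong (λ b → if b then false else φ (x ^ q-1)) (dec-false (x ≟ 0#) x≢0)

    fφ-scale : ∀ {t} → t ≢ 0# → t ^ q-1 ≡ 1# → ∀ x → fφ (t * x) ≡ fφ x
    fφ-scale {t} t≢0 t^[q-1]≡1 x = scale (x ≟ 0#)
      where
      scale : Dec (x ≡ 0#) → fφ (t * x) ≡ fφ x
      scale (yes refl) = cong fφ (zeroʳ t)
      scale (no x≢0) = trans (fφ-≢0 (*-≢0 t≢0 x≢0))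
        (trans (cong φ (trans (^-distribʳ-* t x q-1) (trans (cong (_* x ^ q-1) t^[q-1]≡1) (*-identityˡ _))))
          (sym (fφ-≢0 x≢0)))

    W : F → ℤ
    W = walsh 𝔽 fφ

    T : ℤ
    T = sumMap (λ x → sgn (fφ x)) elems

    Z : F → ℤ
    Z b = sumMap (λ x → [ does (((b * x) ^ q) ≟ (b * x)) ]· sgn (fφ x)) elems

    S : ℤ
    S = sumBelow q+1 (λ r → sgn (φ (v ^ r)))

    W≡sum-χ : ∀ b → W b ≡ sumMap (λ x → sgn (fφ x) ℤ.* χ (b * x)) elems
    W≡sum-χ b = sumMap-cong elems (λ x → sgn-xor (fφ x) (Tr (b * x)))

    W-rotate : ∀ b t → W b ≡ sumMap (λ x → sgn (fφ x) ℤ.* χ (β ^ t * (b * x))) elems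
    W-rotate b t = trans (W≡sum-χ b) (trans
      (sym (sum-elems-reindex (λ x → sgn (fφ x) ℤ.* χ (b * x)) (β ^ t *_) ((β ^ t) ⁻¹ *_) β^t*[β^-t*x]≡x))
      (sumMap-cong elems (λ x → cong₂ ℤ._*_ (cong sgn (fφ-scale (^-≢0 t β≢0) (β^t^[q-1]≡1 t) x))
        (cong χ (solve 3 (λ b c x → (b ⊗ (c ⊗ x)) ⊜ (c ⊗ (b ⊗ x))) refl b (β ^ t) x)))))
      where
      β^t*[β^-t*x]≡x : ∀ x → β ^ t * ((β ^ t) ⁻¹ * x) ≡ x
      β^t*[β^-t*x]≡x x = trans (sym (*-assoc _ _ _)) (trans (cong (_* x) (inverseʳ _ (^-≢0 t β≢0))) (*-identityˡ x))

    -- Average over the q - 1 rotations b ↦ β^t b, which all leave W b unchanged.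
    [q-1]*W≡q*Z-T : ∀ b → ℤ.+ q-1 ℤ.* W b ≡ ℤ.+ q ℤ.* Z b ℤ.- T
    [q-1]*W≡q*Z-T b = begin
      ℤ.+ q-1 ℤ.* W b
        ≡⟨ sym (sumBelow-const q-1 (W b)) ⟩
      sumBelow q-1 (λ t → W b)
        ≡⟨ sumBelow-cong q-1 (λ t _ → W-rotate b t) ⟩
      sumBelow q-1 (λ t → sumMap (λ x → sgn (fφ x) ℤ.* χ (β ^ t * (b * x))) elems)
        ≡⟨ sumBelow-sumMap q-1 (λ t x → sgn (fφ x) ℤ.* χ (β ^ t * (b * x))) elems ⟩
      sumMap (λ x → sumBelow q-1 (λ t → sgn (fφ x) ℤ.* χ (β ^ t * (b * x)))) elems
        ≡⟨ sumMap-cong elems (λ x → trans (sumBelow-* q-1 (sgn (fφ x)) (λ t → χ (β ^ t * (b * x))))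
             (trans (cong (sgn (fφ x) ℤ.*_) (sumBelow-χ-β^ (b * x))) (distribute (does (((b * x) ^ q) ≟ (b * x))) (sgn (fφ x))))) ⟩
      sumMap (λ x → ℤ.+ q ℤ.* ([ does (((b * x) ^ q) ≟ (b * x)) ]· sgn (fφ x)) ℤ.- sgn (fφ x)) elems
        ≡⟨ sumMap-sub _ _ elems ⟩
      sumMap (λ x → ℤ.+ q ℤ.* ([ does (((b * x) ^ q) ≟ (b * x)) ]· sgn (fφ x))) elems ℤ.- T
        ≡⟨ cong (ℤ._- T) (sumMap-* (ℤ.+ q) _ elems) ⟩
      ℤ.+ q ℤ.* Z b ℤ.- T ∎
      where
      distribute : ∀ c z → z ℤ.* (([ c ]· ℤ.+ q) ℤ.- ℤ.+ 1) ≡ ℤ.+ q ℤ.* ([ c ]· z) ℤ.- z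
      distribute true z = ℤS.solve 2 (λ z Q → z ℤS.:* (Q ℤS.:- ℤS.con (ℤ.+ 1)) ℤS.:= Q ℤS.:* z ℤS.:- z) refl z (ℤ.+ q)
      distribute false z = ℤS.solve 2 (λ z Q → z ℤS.:* (ℤS.con (ℤ.+ 0) ℤS.:- ℤS.con (ℤ.+ 1)) ℤS.:= Q ℤS.:* ℤS.con (ℤ.+ 0) ℤS.:- z)
                              refl z (ℤ.+ q)

    Z≡1+[q-1]*sgn : ∀ {b} → b ≢ 0# → Z b ≡ ℤ.+ 1 ℤ.+ ℤ.+ q-1 ℤ.* sgn (fφ (b ⁻¹))
    Z≡1+[q-1]*sgn {b} b≢0 = begin
      Z b
        ≡⟨ sym (sum-elems-reindex g (b ⁻¹ *_) (b *_) b⁻¹*[b*x]≡x) ⟩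
      sumMap (λ y → g (b ⁻¹ * y)) elems
        ≡⟨ sumMap-cong elems (λ y → cong (λ z → [ does ((z ^ q) ≟ z) ]· sgn (fφ (b ⁻¹ * y))) (b*[b⁻¹*y]≡y y)) ⟩
      sumFq (λ y → sgn (fφ (b ⁻¹ * y)))
        ≡⟨ sumFq-β^ (λ y → sgn (fφ (b ⁻¹ * y))) ⟩
      sgn (fφ (b ⁻¹ * 0#)) ℤ.+ sumBelow q-1 (λ t → sgn (fφ (b ⁻¹ * β ^ t)))
        ≡⟨ cong₂ ℤ._+_ (cong sgn (trans (cong fφ (zeroʳ _)) fφ-0))
             (sumBelow-cong q-1 (λ t _ → cong sgn (trans (cong fφ (*-comm (b ⁻¹) (β ^ t)))
               (fφ-scale (^-≢0 t β≢0) (β^t^[q-1]≡1 t) (b ⁻¹))))) ⟩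
      ℤ.+ 1 ℤ.+ sumBelow q-1 (λ t → sgn (fφ (b ⁻¹)))
        ≡⟨ cong (λ z → ℤ.+ 1 ℤ.+ z) (sumBelow-const q-1 (sgn (fφ (b ⁻¹)))) ⟩
      ℤ.+ 1 ℤ.+ ℤ.+ q-1 ℤ.* sgn (fφ (b ⁻¹)) ∎
      where
      g : F → ℤ
      g x = [ does (((b * x) ^ q) ≟ (b * x)) ]· sgn (fφ x)
      b⁻¹*[b*x]≡x : ∀ x → b ⁻¹ * (b * x) ≡ x
      b⁻¹*[b*x]≡x x = trans (sym (*-assoc _ _ _)) (trans (cong (_* x) (inverseˡ b b≢0)) (*-identityˡ x))
      b*[b⁻¹*y]≡y : ∀ y → b * (b ⁻¹ * y) ≡ y
      b*[b⁻¹*y]≡y y = trans (sym (*-assoc _ _ _)) (trans (cong (_* y) (inverseʳ b b≢0)) (*-identityˡ y))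

    W-0≡T : W 0# ≡ T
    W-0≡T = sumMap-cong elems (λ x → cong sgn (trans (cong (λ z → fφ x xor Tr z) (zeroˡ x))
      (trans (cong (λ z → fφ x xor bit z) (trace-0 (2 ℕ.* m))) (trans (cong (fφ x xor_) bit-0) (xor-identityʳ (fφ x))))))

    T≡1+[q-1]*S : T ≡ ℤ.+ 1 ℤ.+ ℤ.+ q-1 ℤ.* S
    T≡1+[q-1]*S = begin
      T
        ≡⟨ sum-elems-ω^ (λ x → sgn (fφ x)) ⟩
      sgn (fφ 0#) ℤ.+ sumBelow q²-1 (λ e → sgn (fφ (ω ^ e)))
        ≡⟨ cong₂ ℤ._+_ (cong sgn fφ-0)
             (sumBelow-cong q²-1 (λ e _ → cong sgn (trans (fφ-≢0 (^-≢0 e ω≢0)) (cong φ (^-comm ω e q-1))))) ⟩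
      ℤ.+ 1 ℤ.+ sumBelow q²-1 (λ e → sgn (φ (v ^ e)))
        ≡⟨ cong (λ z → ℤ.+ 1 ℤ.+ z) (sum-v^-periodic (λ z → sgn (φ z))) ⟩
      ℤ.+ 1 ℤ.+ ℤ.+ q-1 ℤ.* S ∎

    -- T ≡ 1 modulo q - 1 ≥ 3, whereas -q ≡ -2.
    T≢-q : T ≢ ℤ.- (ℤ.+ q)
    T≢-q T≡-q = [q-1]*k≢2 (ℤ.∣ S ℤ.+ ℤ.+ 1 ∣) (trans (sym (ℤP.abs-* (ℤ.+ q-1) (S ℤ.+ ℤ.+ 1))) (cong ℤ.∣_∣ [q-1]*[S+1]≡-2))
      where
      [q-1]*[S+1]≡-2 : ℤ.+ q-1 ℤ.* (S ℤ.+ ℤ.+ 1) ≡ ℤ.-[1+ 1 ]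
      [q-1]*[S+1]≡-2 = begin
        ℤ.+ q-1 ℤ.* (S ℤ.+ ℤ.+ 1)
          ≡⟨ ℤS.solve 2 (λ Q S → Q ℤS.:* (S ℤS.:+ ℤS.con (ℤ.+ 1)) ℤS.:= (ℤS.con (ℤ.+ 1) ℤS.:+ Q ℤS.:* S) ℤS.:+ (Q ℤS.:- ℤS.con (ℤ.+ 1)))
               refl (ℤ.+ q-1) S ⟩
        (ℤ.+ 1 ℤ.+ ℤ.+ q-1 ℤ.* S) ℤ.+ (ℤ.+ q-1 ℤ.- ℤ.+ 1)
          ≡⟨ cong (ℤ._+ (ℤ.+ q-1 ℤ.- ℤ.+ 1)) (trans (sym T≡1+[q-1]*S) T≡-q) ⟩
        ℤ.- (ℤ.+ q) ℤ.+ (ℤ.+ q-1 ℤ.- ℤ.+ 1)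
          ≡⟨ cong (λ n → ℤ.- (ℤ.+ n) ℤ.+ (ℤ.+ q-1 ℤ.- ℤ.+ 1)) q≡4+2s ⟩
        ℤ.- (ℤ.+ suc q-1) ℤ.+ (ℤ.+ q-1 ℤ.- ℤ.+ 1)
          ≡⟨ ℤS.solve 1 (λ Q → ℤS.:- (ℤS.con (ℤ.+ 1) ℤS.:+ Q) ℤS.:+ (Q ℤS.:- ℤS.con (ℤ.+ 1)) ℤS.:= ℤS.con ℤ.-[1+ 1 ]) refl (ℤ.+ q-1) ⟩
        ℤ.-[1+ 1 ] ∎
      [q-1]*k≢2 : ∀ k → q-1 ℕ.* k ≢ 2
      [q-1]*k≢2 zero e = case trans (sym (ℕP.*-zeroʳ q-1)) e of λ ()
      [q-1]*k≢2 (suc k) e = case trans (ℕP.*-comm (suc k) q-1) e of λ ()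

    bent⇒T≡q : IsBent 𝔽 m fφ → T ≡ ℤ.+ q
    bent⇒T≡q bent with ∣z∣≡n⇒z≡±n T (trans (cong ℤ.∣_∣ (sym W-0≡T)) (bent 0#))
    ... | inj₁ T≡q = T≡q
    ... | inj₂ T≡-q = ⊥-elim (T≢-q T≡-q)

    T≡q⇒W≡q*sgn : T ≡ ℤ.+ q → ∀ b → W b ≡ ℤ.+ q ℤ.* sgn (fφ (b ⁻¹))
    T≡q⇒W≡q*sgn T≡q b with b ≟ 0#
    ... | yes refl = trans W-0≡T (trans T≡q (trans (sym (ℤP.*-identityʳ (ℤ.+ q)))
                       (cong (λ x → ℤ.+ q ℤ.* sgn x) (sym (trans (cong fφ inv-0) fφ-0)))))
    ... | no b≢0 = ℤP.*-cancelˡ-≡ (ℤ.+ q-1) (W b) (ℤ.+ q ℤ.* sgn (fφ (b ⁻¹))) (begin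
      ℤ.+ q-1 ℤ.* W b
        ≡⟨ [q-1]*W≡q*Z-T b ⟩
      ℤ.+ q ℤ.* Z b ℤ.- T
        ≡⟨ cong₂ (λ z t → ℤ.+ q ℤ.* z ℤ.- t) (Z≡1+[q-1]*sgn b≢0) T≡q ⟩
      ℤ.+ q ℤ.* (ℤ.+ 1 ℤ.+ ℤ.+ q-1 ℤ.* sgn (fφ (b ⁻¹))) ℤ.- ℤ.+ q
        ≡⟨ ℤS.solve 3 (λ Q P e → Q ℤS.:* (ℤS.con (ℤ.+ 1) ℤS.:+ P ℤS.:* e) ℤS.:- Q ℤS.:= P ℤS.:* (Q ℤS.:* e))
             refl (ℤ.+ q) (ℤ.+ q-1) (sgn (fφ (b ⁻¹))) ⟩
      ℤ.+ q-1 ℤ.* (ℤ.+ q ℤ.* sgn (fφ (b ⁻¹))) ∎)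

    T≡q⇒bent : T ≡ ℤ.+ q → IsBent 𝔽 m fφ
    T≡q⇒bent T≡q b = trans (cong ℤ.∣_∣ (T≡q⇒W≡q*sgn T≡q b))
      (trans (ℤP.abs-* (ℤ.+ q) (sgn (fφ (b ⁻¹)))) (trans (cong (q ℕ.*_) (∣sgn∣≡1 (fφ (b ⁻¹)))) (ℕP.*-identityʳ q)))

    T≡q⇔S≡1 : T ≡ ℤ.+ q ⇔ S ≡ ℤ.+ 1
    T≡q⇔S≡1 = mk⇔
      (λ T≡q → ℤP.*-cancelˡ-≡ (ℤ.+ q-1) S (ℤ.+ 1)
        (trans (ℤ-+-cancelˡ (ℤ.+ 1) {c = ℤ.+ q-1} (trans (sym T≡1+[q-1]*S) (trans T≡q (cong ℤ.+_ q≡4+2s)))) (sym (ℤP.*-identityʳ (ℤ.+ q-1)))))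
      (λ S≡1 → trans T≡1+[q-1]*S (trans (cong (λ z → ℤ.+ 1 ℤ.+ ℤ.+ q-1 ℤ.* z) S≡1)
        (trans (cong (λ z → ℤ.+ 1 ℤ.+ z) (ℤP.*-identityʳ (ℤ.+ q-1))) (cong ℤ.+_ (sym q≡4+2s)))))

    bent⇔T≡q : IsBent 𝔽 m fφ ⇔ T ≡ ℤ.+ q
    bent⇔T≡q = mk⇔ bent⇒T≡q T≡q⇒bent

  -- u is the generator of μ_(q+1) from the statement, with u⁻² = v.

  u : F
  u = ω ^ ((q ℕ.∸ 1) ℕ.* (2 ℕ.^ (2 ℕ.* m ℕ.∸ 1) ℕ.∸ 1))

  2^[2m-1]≡8+8s+2s² : 2 ℕ.^ (2 ℕ.* m ℕ.∸ 1) ≡ 8 ℕ.+ 8 ℕ.* s ℕ.+ 2 ℕ.* (s ℕ.* s)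
  2^[2m-1]≡8+8s+2s² = ℕP.*-cancelˡ-≡ _ _ 2 (begin
      2 ℕ.* 2 ℕ.^ (2 ℕ.* m ℕ.∸ 1)            ≡⟨ cong (2 ℕ.^_) (ℕP.m+[n∸m]≡n {1} {2 ℕ.* m} 1≤2m) ⟩
      2 ℕ.^ (2 ℕ.* m)                        ≡⟨ 2^[2m]≡q*q ⟩
      q ℕ.* q                                ≡⟨ cong₂ ℕ._*_ q≡4+2s q≡4+2s ⟩
      (4 ℕ.+ 2 ℕ.* s) ℕ.* (4 ℕ.+ 2 ℕ.* s)    ≡⟨ ℕS.solve 1 (λ s → (con 4 :+ con 2 :* s) :* (con 4 :+ con 2 :* s)
                                                    := con 2 :* (con 8 :+ con 8 :* s :+ con 2 :* (s :* s))) refl s ⟩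
      2 ℕ.* (8 ℕ.+ 8 ℕ.* s ℕ.+ 2 ℕ.* (s ℕ.* s)) ∎)
    where
    1≤2m : 1 ≤ 2 ℕ.* m
    1≤2m = ℕP.*-mono-≤ {1} {2} (s≤s z≤n) (ℕP.n≢0⇒n>0 m≢0)

  u≡ω^ : u ≡ ω ^ (q-1 ℕ.* (7 ℕ.+ 8 ℕ.* s ℕ.+ 2 ℕ.* (s ℕ.* s)))
  u≡ω^ = cong (ω ^_) (cong₂ ℕ._*_ (cong (ℕ._∸ 1) q≡4+2s) (cong (ℕ._∸ 1) 2^[2m-1]≡8+8s+2s²))

  u^[q-1]≡v : u ^ q-1 ≡ v
  u^[q-1]≡v = begin
    u ^ q-1
      ≡⟨ trans (cong (_^ q-1) u≡ω^) (sym (^-* ω (q-1 ℕ.* (7 ℕ.+ 8 ℕ.* s ℕ.+ 2 ℕ.* (s ℕ.* s))) q-1)) ⟩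
    ω ^ (q-1 ℕ.* (7 ℕ.+ 8 ℕ.* s ℕ.+ 2 ℕ.* (s ℕ.* s)) ℕ.* q-1)
      ≡⟨ cong (ω ^_) (ℕS.solve 1 (λ s → ((con 3 :+ con 2 :* s) :* (con 7 :+ con 8 :* s :+ con 2 :* (s :* s))) :* (con 3 :+ con 2 :* s)
           := (con 4 :+ con 6 :* s :+ con 2 :* (s :* s)) :* ((con 3 :+ con 2 :* s) :* (con 5 :+ con 2 :* s)) :+ (con 3 :+ con 2 :* s)) refl s) ⟩
    ω ^ ((4 ℕ.+ 6 ℕ.* s ℕ.+ 2 ℕ.* (s ℕ.* s)) ℕ.* q²-1 ℕ.+ q-1)
      ≡⟨ ^-period q²-1 (4 ℕ.+ 6 ℕ.* s ℕ.+ 2 ℕ.* (s ℕ.* s)) q-1 ω^M≡1 ⟩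
    v ∎

  u^[q+1]≡1 : u ^ q+1 ≡ 1#
  u^[q+1]≡1 = begin
    u ^ q+1
      ≡⟨ trans (cong (_^ q+1) u≡ω^) (sym (^-* ω (q-1 ℕ.* (7 ℕ.+ 8 ℕ.* s ℕ.+ 2 ℕ.* (s ℕ.* s))) q+1)) ⟩
    ω ^ (q-1 ℕ.* (7 ℕ.+ 8 ℕ.* s ℕ.+ 2 ℕ.* (s ℕ.* s)) ℕ.* q+1)
      ≡⟨ cong (ω ^_) (ℕS.solve 1 (λ s → ((con 3 :+ con 2 :* s) :* (con 7 :+ con 8 :* s :+ con 2 :* (s :* s))) :* (con 5 :+ con 2 :* s)
           := (con 7 :+ con 8 :* s :+ con 2 :* (s :* s)) :* ((con 3 :+ con 2 :* s) :* (con 5 :+ con 2 :* s))) refl s) ⟩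
    ω ^ ((7 ℕ.+ 8 ℕ.* s ℕ.+ 2 ℕ.* (s ℕ.* s)) ℕ.* q²-1)
      ≡⟨ ^-*-≡1 q²-1 (7 ℕ.+ 8 ℕ.* s ℕ.+ 2 ℕ.* (s ℕ.* s)) ω^M≡1 ⟩
    1# ∎

  u≢0 : u ≢ 0#
  u≢0 = ^-≢0 ((q ℕ.∸ 1) ℕ.* (2 ℕ.^ (2 ℕ.* m ℕ.∸ 1) ℕ.∸ 1)) ω≢0

  u⁻¹^2≡v : (u ⁻¹) ^ 2 ≡ v
  u⁻¹^2≡v = begin
    (u ⁻¹) ^ 2              ≡⟨ cong (_^ 2) (sym (x*y≡1⇒y≡x⁻¹ (trans (cong (u ^_) (cong suc q≡4+2s)) u^[q+1]≡1))) ⟩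
    (u ^ q) ^ 2             ≡⟨ sym (^-* u q 2) ⟩
    u ^ (q ℕ.* 2)           ≡⟨ cong (u ^_) (trans (cong (ℕ._* 2) q≡4+2s)
                                 (ℕS.solve 1 (λ s → (con 4 :+ con 2 :* s) :* con 2 := (con 3 :+ con 2 :* s) :+ (con 5 :+ con 2 :* s)) refl s)) ⟩
    u ^ (q-1 ℕ.+ q+1)       ≡⟨ ^-distribˡ-+-* u q-1 q+1 ⟩
    u ^ q-1 * u ^ q+1       ≡⟨ cong₂ _*_ u^[q-1]≡v u^[q+1]≡1 ⟩
    v * 1#                  ≡⟨ *-identityʳ v ⟩
    v                       ∎

  u^2≡v⁻¹ : u ^ 2 ≡ v ⁻¹
  u^2≡v⁻¹ = x*y≡1⇒y≡x⁻¹ (trans (cong (_* u ^ 2) (sym u^[q-1]≡v))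
    (trans (sym (^-distribˡ-+-* u q-1 2)) (trans (cong (u ^_) (ℕP.+-comm q-1 2)) u^[q+1]≡1)))

  u⁻¹^[2il]≡[v^i]^l : ∀ i l → (u ⁻¹) ^ (2 ℕ.* i ℕ.* l) ≡ (v ^ i) ^ l
  u⁻¹^[2il]≡[v^i]^l i l = trans (^-* (u ⁻¹) (2 ℕ.* i) l) (cong (_^ l) (trans (^-* (u ⁻¹) 2 i) (cong (_^ i) u⁻¹^2≡v)))

  u^[2i]≡v⁻¹^i : ∀ i → u ^ (2 ℕ.* i) ≡ (v ⁻¹) ^ i
  u^[2i]≡v⁻¹^i i = trans (^-* u 2 i) (cong (_^ i) u^2≡v⁻¹)

  [u^i]^[q-1]≡v^i : ∀ i → (u ^ i) ^ q-1 ≡ v ^ i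
  [u^i]^[q-1]≡v^i i = trans (^-comm u i q-1) (cong (_^ i) u^[q-1]≡v)

module BentCriterion (m s : ℕ) (q≡4+2s : 2 ℕ.^ m ≡ 4 ℕ.+ 2 ℕ.* s) (𝔽 : GF2^ (2 ℕ.* m))
         (ω : GF2^.F 𝔽) (ω-primitive : GF2^.IsPrimitive 𝔽 ω)
         (a₁ a₂ : GF2^.F 𝔽) (a₂≢0 : a₂ ≢ GF2^.0# 𝔽) (l₁ l₂ : ℕ) (l₂⊥q+1 : gcd l₂ (2 ℕ.^ m ℕ.+ 1) ≡ 1)
         (I : Subset (2 ℕ.^ m)) where
  open FieldProperties 𝔽
  open Setting m s q≡4+2s 𝔽 ω ω-primitive

  InN : F → Set
  InN x = Σ (Fin q) λ i → i ∈ I × Σ F λ y → (y ^ q ≡ y) × (y ≢ 0#) × (x ≡ u ^ toℕ i * y)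

  InD : F → Set
  InD x = Σ (Fin q) λ i → i ∈ I × (x ^ (q ℕ.∸ 1) ≡ u ^ (2 ℕ.* toℕ i))

  -- The image of N under x ↦ x^(q-1).
  InV : F → Set
  InV z = ∃ λ (i : Fin q) → i ∈ I × z ≡ v ^ toℕ i

  InV? : ∀ z → Dec (InV z)
  InV? z = Finₚ.any? (λ i → (i ∈? I) ×-dec (z ≟ (v ^ toℕ i)))

  φ : F → Bool
  φ z = if does (InV? z) then Tr (a₁ * z ^ l₁) else Tr (a₂ * z ^ l₂)

  φ-InV : ∀ {z} → InV z → φ z ≡ Tr (a₁ * z ^ l₁)
  φ-InV {z} z∈V = cong (λ b → if b then Tr (a₁ * z ^ l₁) else Tr (a₂ * z ^ l₂)) (dec-true (InV? z) z∈V)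

  φ-¬InV : ∀ {z} → ¬ InV z → φ z ≡ Tr (a₂ * z ^ l₂)
  φ-¬InV {z} z∉V = cong (λ b → if b then Tr (a₁ * z ^ l₁) else Tr (a₂ * z ^ l₂)) (dec-false (InV? z) z∉V)

  open Walsh φ

  InV-v^ : ∀ (i : Fin q) → InV (v ^ toℕ i) → i ∈ I
  InV-v^ i (j , j∈I , v^i≡v^j) = subst (_∈ I) (sym (Finₚ.toℕ-injective i≡j)) j∈I
    where
    i≡j : toℕ i ≡ toℕ j
    i≡j = v^-injective (ℕP.m<n⇒m<1+n (subst (toℕ i <_) q≡4+2s (Finₚ.toℕ<n i)))
                       (ℕP.m<n⇒m<1+n (subst (toℕ j <_) q≡4+2s (Finₚ.toℕ<n j))) v^i≡v^j

  ¬InV-v^q : ¬ InV (v ^ q)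
  ¬InV-v^q (j , _ , v^q≡v^j) = ℕP.<-irrefl (sym q≡j) (Finₚ.toℕ<n j)
    where
    q≡j : q ≡ toℕ j
    q≡j = v^-injective (subst (_< q+1) (sym q≡4+2s) (ℕP.n<1+n _))
                       (ℕP.m<n⇒m<1+n (subst (toℕ j <_) q≡4+2s (Finₚ.toℕ<n j))) v^q≡v^j

  InN⇒InV : ∀ {x} → InN x → InV (x ^ q-1)
  InN⇒InV {x} (i , i∈I , y , y∈Fq , y≢0 , x≡u^i*y) = i , i∈I , (begin
    x ^ q-1                          ≡⟨ cong (_^ q-1) x≡u^i*y ⟩
    (u ^ toℕ i * y) ^ q-1            ≡⟨ ^-distribʳ-* (u ^ toℕ i) y q-1 ⟩
    (u ^ toℕ i) ^ q-1 * y ^ q-1      ≡⟨ cong₂ _*_ ([u^i]^[q-1]≡v^i (toℕ i)) (Fq*⇒^[q-1]≡1 y≢0 y∈Fq) ⟩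
    v ^ toℕ i * 1#                   ≡⟨ *-identityʳ _ ⟩
    v ^ toℕ i                        ∎)

  InV⇒InN : ∀ {x} → x ≢ 0# → InV (x ^ q-1) → InN x
  InV⇒InN {x} x≢0 (i , i∈I , x^[q-1]≡v^i) = i , i∈I , x * U ⁻¹ , y∈Fq , *-≢0 x≢0 (⁻¹-≢0 U≢0) , x≡U*y
    where
    U : F
    U = u ^ toℕ i
    U≢0 : U ≢ 0#
    U≢0 = ^-≢0 (toℕ i) u≢0
    x≡U*y : x ≡ U * (x * U ⁻¹)
    x≡U*y = sym (trans (solve 3 (λ U x i → (U ⊗ (x ⊗ i)) ⊜ (x ⊗ (U ⊗ i))) refl U x (U ⁻¹))
                   (trans (cong (x *_) (inverseʳ U U≢0)) (*-identityʳ x)))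
    y∈Fq : (x * U ⁻¹) ^ q ≡ x * U ⁻¹
    y∈Fq = ^[q-1]≡1⇒Fq (trans (^-distribʳ-* x (U ⁻¹) q-1)
      (trans (cong₂ _*_ x^[q-1]≡v^i (trans (⁻¹-^ U q-1) (cong _⁻¹ ([u^i]^[q-1]≡v^i (toℕ i)))))
        (inverseʳ _ (^-≢0 (toℕ i) v≢0))))

  b^[q-1]≡u^2i⇔b⁻¹^[q-1]≡v^i : ∀ {b} i → b ^ q-1 ≡ u ^ (2 ℕ.* i) ⇔ (b ⁻¹) ^ q-1 ≡ v ^ i
  b^[q-1]≡u^2i⇔b⁻¹^[q-1]≡v^i {b} i = mk⇔
    (λ b^[q-1]≡u^2i → trans (⁻¹-^ b q-1) (trans (cong _⁻¹ (trans b^[q-1]≡u^2i (u^[2i]≡v⁻¹^i i)))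
                         (trans (cong _⁻¹ (⁻¹-^ v i)) (⁻¹-involutive _))))
    (λ b⁻¹^[q-1]≡v^i → trans (sym (⁻¹-involutive (b ^ q-1))) (trans (cong _⁻¹ (sym (⁻¹-^ b q-1)))
                          (trans (cong _⁻¹ b⁻¹^[q-1]≡v^i) (trans (sym (⁻¹-^ v i)) (sym (u^[2i]≡v⁻¹^i i))))))

  InD⇔InV : ∀ {b} → InD b ⇔ InV ((b ⁻¹) ^ q-1)
  InD⇔InV {b} = mk⇔
    (λ (i , i∈I , e) → i , i∈I , Equivalence.to (b^[q-1]≡u^2i⇔b⁻¹^[q-1]≡v^i (toℕ i)) (trans (sym (x^[q∸1]≡x^[q-1] b)) e))
    (λ (i , i∈I , e) → i , i∈I , trans (x^[q∸1]≡x^[q-1] b) (Equivalence.from (b^[q-1]≡u^2i⇔b⁻¹^[q-1]≡v^i (toℕ i)) e))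

  l₂≢0 : l₂ ≢ 0
  l₂≢0 refl = case trans (cong suc (sym q≡4+2s)) (trans (ℕP.+-comm 1 q) (trans (sym (gcd-identityˡ (q ℕ.+ 1))) l₂⊥q+1))
    of λ ()

  Tr[a*0^e]≡false : ∀ a e → 0 < e → Tr (a * 0# ^ e) ≡ false
  Tr[a*0^e]≡false a e 0<e = trans (cong Tr (trans (cong (a *_) (0^pos e 0<e)) (zeroʳ a)))
    (trans (cong bit (trace-0 (2 ℕ.* m))) bit-0)

  0<l₂*e : ∀ {e} → 0 < e → 0 < l₂ ℕ.* e
  0<l₂*e 0<e = ℕP.*-mono-≤ (ℕP.n≢0⇒n>0 l₂≢0) 0<e

  x^[l*[q∸1]]≡[x^[q-1]]^l : ∀ x l → x ^ (l ℕ.* (q ℕ.∸ 1)) ≡ (x ^ q-1) ^ l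
  x^[l*[q∸1]]≡[x^[q-1]]^l x l = trans (cong (λ e → x ^ (l ℕ.* e)) q∸1≡q-1) (^-*′ x l q-1)

  -- x^(q-1) lies in μ_(q+1), where raising to the q-th power inverts.
  x^[l*[q*q∸q]]≡[x⁻¹^[q-1]]^l : ∀ {x} → x ≢ 0# → ∀ l → x ^ (l ℕ.* (q ℕ.* q ℕ.∸ q)) ≡ ((x ⁻¹) ^ q-1) ^ l
  x^[l*[q*q∸q]]≡[x⁻¹^[q-1]]^l {x} x≢0 l = begin
    x ^ (l ℕ.* (q ℕ.* q ℕ.∸ q))    ≡⟨ cong (λ e → x ^ (l ℕ.* e)) q*q∸q≡[q-1]*q ⟩
    x ^ (l ℕ.* (q-1 ℕ.* q))        ≡⟨ trans (^-*′ x l (q-1 ℕ.* q)) (cong (_^ l) (^-* x q-1 q)) ⟩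
    ((x ^ q-1) ^ q) ^ l            ≡⟨ cong (_^ l) (^q≡⁻¹ x^[q-1]^[q+1]≡1) ⟩
    ((x ^ q-1) ⁻¹) ^ l             ≡⟨ cong (_^ l) (sym (⁻¹-^ x q-1)) ⟩
    ((x ⁻¹) ^ q-1) ^ l             ∎
    where
    q*q∸q≡[q-1]*q : q ℕ.* q ℕ.∸ q ≡ q-1 ℕ.* q
    q*q∸q≡[q-1]*q = trans (cong (q ℕ.* q ℕ.∸_) (sym (ℕP.*-identityˡ q)))
      (trans (sym (ℕP.*-distribʳ-∸ q q 1)) (cong (ℕ._* q) q∸1≡q-1))
    x^[q-1]^[q+1]≡1 : (x ^ q-1) ^ q+1 ≡ 1#
    x^[q-1]^[q+1]≡1 = trans (sym (^-* x q-1 q+1)) (x^M≡1 x≢0)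

  module _ (f : F → Bool)
           (f-N : ∀ x → InN x → f x ≡ Tr (a₁ * x ^ (l₁ ℕ.* (q ℕ.∸ 1))))
           (f-¬N : ∀ x → ¬ InN x → f x ≡ Tr (a₂ * x ^ (l₂ ℕ.* (q ℕ.∸ 1)))) where

    f≗fφ : ∀ x → f x ≡ fφ x
    f≗fφ x = by-cases (x ≟ 0#)
      where
      by-cases : Dec (x ≡ 0#) → f x ≡ fφ x
      by-cases (yes refl) = trans (f-¬N 0# (λ { (i , _ , y , _ , y≢0 , 0≡u^i*y) → *-≢0 (^-≢0 (toℕ i) u≢0) y≢0 (sym 0≡u^i*y) }))
        (trans (Tr[a*0^e]≡false a₂ _ (0<l₂*e (subst (0 <_) (sym q∸1≡q-1) (s≤s z≤n)))) (sym fφ-0))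
      by-cases (no x≢0) = by-InV (InV? (x ^ q-1))
        where
        by-InV : Dec (InV (x ^ q-1)) → f x ≡ fφ x
        by-InV (yes x∈N) = trans (f-N x (InV⇒InN x≢0 x∈N))
          (trans (cong (λ z → Tr (a₁ * z)) (x^[l*[q∸1]]≡[x^[q-1]]^l x l₁)) (trans (sym (φ-InV x∈N)) (sym (fφ-≢0 x≢0))))
        by-InV (no x∉N) = trans (f-¬N x (λ x∈N → x∉N (InN⇒InV x∈N)))
          (trans (cong (λ z → Tr (a₂ * z)) (x^[l*[q∸1]]≡[x^[q-1]]^l x l₂)) (trans (sym (φ-¬InV x∉N)) (sym (fφ-≢0 x≢0))))

  module _ (g : F → Bool)
           (g-D : ∀ x → InD x → g x ≡ Tr (a₁ * x ^ (l₁ ℕ.* (q ℕ.* q ℕ.∸ q))))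
           (g-¬D : ∀ x → ¬ InD x → g x ≡ Tr (a₂ * x ^ (l₂ ℕ.* (q ℕ.* q ℕ.∸ q)))) where

    g≗fφ∘⁻¹ : ∀ b → g b ≡ fφ (b ⁻¹)
    g≗fφ∘⁻¹ b = by-cases (b ≟ 0#)
      where
      by-cases : Dec (b ≡ 0#) → g b ≡ fφ (b ⁻¹)
      by-cases (yes refl) = trans (g-¬D 0# ¬InD-0) (trans (Tr[a*0^e]≡false a₂ _ (0<l₂*e 0<q*q∸q)) (sym (trans (cong fφ inv-0) fφ-0)))
        where
        ¬InD-0 : ¬ InD 0#
        ¬InD-0 (i , _ , 0^[q∸1]≡u^2i) = ^-≢0 (2 ℕ.* toℕ i) u≢0 (trans (sym 0^[q∸1]≡u^2i) (trans (x^[q∸1]≡x^[q-1] 0#) (zeroˡ _)))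
        0<q*q∸q : 0 < q ℕ.* q ℕ.∸ q
        0<q*q∸q = subst (0 <_) (trans (ℕP.*-distribʳ-∸ q q 1) (cong (q ℕ.* q ℕ.∸_) (ℕP.*-identityˡ q)))
          (ℕP.*-mono-≤ (subst (0 <_) (sym q∸1≡q-1) (s≤s z≤n)) (subst (0 <_) (sym q≡4+2s) (s≤s z≤n)))
      by-cases (no b≢0) = by-InV (InV? ((b ⁻¹) ^ q-1))
        where
        by-InV : Dec (InV ((b ⁻¹) ^ q-1)) → g b ≡ fφ (b ⁻¹)
        by-InV (yes b∈D) = trans (g-D b (Equivalence.from InD⇔InV b∈D))
          (trans (cong (λ z → Tr (a₁ * z)) (x^[l*[q*q∸q]]≡[x⁻¹^[q-1]]^l b≢0 l₁))
            (trans (sym (φ-InV b∈D)) (sym (fφ-≢0 (⁻¹-≢0 b≢0)))))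
        by-InV (no b∉D) = trans (g-¬D b (λ b∈D → b∉D (Equivalence.to InD⇔InV b∈D)))
          (trans (cong (λ z → Tr (a₂ * z)) (x^[l*[q*q∸q]]≡[x⁻¹^[q-1]]^l b≢0 l₂))
            (trans (sym (φ-¬InV b∉D)) (sym (fφ-≢0 (⁻¹-≢0 b≢0)))))

  D : F → ℤ
  D z = sgn (Tr (a₁ * z ^ l₁)) ℤ.- sgn (Tr (a₂ * z ^ l₂))

  ΣI : ℤ
  ΣI = sumSubset I (λ i → sgn (Tr (a₁ * (u ⁻¹) ^ (2 ℕ.* toℕ i ℕ.* l₁))) ℤ.- sgn (Tr (a₂ * (u ⁻¹) ^ (2 ℕ.* toℕ i ℕ.* l₂))))

  Kl : ℤ
  Kl = kloosterman 𝔽 m (a₂ ^ (q ℕ.+ 1))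

  InV-v^≡lookup : ∀ (i : Fin q) → does (InV? (v ^ toℕ i)) ≡ lookup I i
  InV-v^≡lookup i = does≡ (InV? (v ^ toℕ i)) (lookup I i)
    (λ v^i∈V → []=⇒lookup (InV-v^ i v^i∈V)) (λ i∈I → i , lookup⇒[]= i I i∈I , refl)

  sumBelow-InV≡ΣI : sumBelow q+1 (λ r → [ does (InV? (v ^ r)) ]· D (v ^ r)) ≡ ΣI
  sumBelow-InV≡ΣI = begin
    sumBelow q+1 h                      ≡⟨ cong (λ n → sumBelow n h) (sym (cong suc q≡4+2s)) ⟩
    sumBelow (suc q) h                  ≡⟨ sumBelow-last q h ⟩
    sumBelow q h ℤ.+ h q                ≡⟨ cong (λ z → sumBelow q h ℤ.+ z) ([]·-no (InV? (v ^ q)) (D (v ^ q)) ¬InV-v^q) ⟩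
    sumBelow q h ℤ.+ ℤ.+ 0              ≡⟨ ℤP.+-identityʳ _ ⟩
    sumBelow q h                        ≡⟨ sym (sumFin-sumBelow q _ h summand) ⟩
    ΣI                                  ∎
    where
    h : ℕ → ℤ
    h r = [ does (InV? (v ^ r)) ]· D (v ^ r)
    summand : ∀ i → h (toℕ i) ≡ (if lookup I i then sgn (Tr (a₁ * (u ⁻¹) ^ (2 ℕ.* toℕ i ℕ.* l₁)))
                                                     ℤ.- sgn (Tr (a₂ * (u ⁻¹) ^ (2 ℕ.* toℕ i ℕ.* l₂))) else ℤ.+ 0)
    summand i = cong₂ [_]·_ (InV-v^≡lookup i)
      (sym (cong₂ (λ x y → sgn (Tr (a₁ * x)) ℤ.- sgn (Tr (a₂ * y))) (u⁻¹^[2il]≡[v^i]^l (toℕ i) l₁) (u⁻¹^[2il]≡[v^i]^l (toℕ i) l₂)))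

  S≡1-Kl+ΣI : S ≡ (ℤ.+ 1 ℤ.- Kl) ℤ.+ ΣI
  S≡1-Kl+ΣI = begin
    S
      ≡⟨ sumBelow-cong q+1 (λ r _ → sgn-if (does (InV? (v ^ r))) (Tr (a₁ * (v ^ r) ^ l₁)) (Tr (a₂ * (v ^ r) ^ l₂))) ⟩
    sumBelow q+1 (λ r → χ (a₂ * (v ^ r) ^ l₂) ℤ.+ ([ does (InV? (v ^ r)) ]· D (v ^ r)))
      ≡⟨ sumBelow-+ q+1 (λ r → χ (a₂ * (v ^ r) ^ l₂)) (λ r → [ does (InV? (v ^ r)) ]· D (v ^ r)) ⟩
    sumBelow q+1 (λ r → χ (a₂ * (v ^ r) ^ l₂)) ℤ.+ sumBelow q+1 (λ r → [ does (InV? (v ^ r)) ]· D (v ^ r))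
      ≡⟨ cong₂ ℤ._+_ sum-χ[a₂v^rl₂]≡1-Kl sumBelow-InV≡ΣI ⟩
    (ℤ.+ 1 ℤ.- Kl) ℤ.+ ΣI ∎
    where
    q+1≡5+2s : q ℕ.+ 1 ≡ q+1
    q+1≡5+2s = trans (ℕP.+-comm q 1) (cong suc q≡4+2s)
    sum-χ[a₂v^rl₂]≡1-Kl : sumBelow q+1 (λ r → χ (a₂ * (v ^ r) ^ l₂)) ≡ ℤ.+ 1 ℤ.- Kl
    sum-χ[a₂v^rl₂]≡1-Kl = trans
      (sumBelow-v^-^l l₂ (Coprime.sym (gcd≡1⇒coprime (subst (λ n → gcd l₂ n ≡ 1) q+1≡5+2s l₂⊥q+1))) (λ z → χ (a₂ * z)))
      (trans (sumμ-χ≡1-kloosterman a₂ a₂≢0) (cong (λ e → ℤ.+ 1 ℤ.- kloosterman 𝔽 m (a₂ ^ e)) (sym q+1≡5+2s)))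

  S≡1⇔ΣI≡Kl : S ≡ ℤ.+ 1 ⇔ ΣI ≡ Kl
  S≡1⇔ΣI≡Kl = mk⇔
    (λ S≡1 → ℤ-+-cancelˡ (ℤ.+ 1 ℤ.- Kl) (trans (sym S≡1-Kl+ΣI) (trans S≡1 (sym (1-Kl+Kl≡1 Kl)))))
    (λ ΣI≡Kl → trans S≡1-Kl+ΣI (trans (cong (λ z → (ℤ.+ 1 ℤ.- Kl) ℤ.+ z) ΣI≡Kl) (1-Kl+Kl≡1 Kl)))
    where
    1-Kl+Kl≡1 : ∀ k → (ℤ.+ 1 ℤ.- k) ℤ.+ k ≡ ℤ.+ 1
    1-Kl+Kl≡1 = ℤS.solve 1 (λ k → (ℤS.con (ℤ.+ 1) ℤS.:- k) ℤS.:+ k ℤS.:= ℤS.con (ℤ.+ 1)) refl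

  walsh≡W : ∀ {f} → (∀ x → f x ≡ fφ x) → ∀ b → walsh 𝔽 f b ≡ W b
  walsh≡W f≗fφ b = sumMap-cong elems (λ x → cong (λ c → sgn (c xor Tr (b * x))) (f≗fφ x))

  bent⇔bentφ : ∀ {f} → (∀ x → f x ≡ fφ x) → IsBent 𝔽 m f ⇔ IsBent 𝔽 m fφ
  bent⇔bentφ f≗fφ = mk⇔ (λ bent b → trans (cong ℤ.∣_∣ (sym (walsh≡W f≗fφ b))) (bent b))
                        (λ bent b → trans (cong ℤ.∣_∣ (walsh≡W f≗fφ b)) (bent b))

  bent⇔ΣI≡Kl : ∀ {f} → (∀ x → f x ≡ fφ x) → IsBent 𝔽 m f ⇔ ΣI ≡ Kl
  bent⇔ΣI≡Kl f≗fφ = ⇔.trans (bent⇔bentφ f≗fφ) (⇔.trans bent⇔T≡q (⇔.trans T≡q⇔S≡1 S≡1⇔ΣI≡Kl))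

  dual : ∀ {f g} → (∀ x → f x ≡ fφ x) → (∀ b → g b ≡ fφ (b ⁻¹)) → IsBent 𝔽 m f → IsDualOf 𝔽 m g f
  dual f≗fφ g≗fφ∘⁻¹ bent b = trans (walsh≡W f≗fφ b)
    (trans (T≡q⇒W≡q*sgn (Equivalence.to (⇔.trans (bent⇔bentφ f≗fφ) bent⇔T≡q) bent) b)
      (cong (λ c → ℤ.+ q ℤ.* sgn c) (sym (g≗fφ∘⁻¹ b))))

2^m≡4+2s : ∀ m → 2 ≤ m → ∃ λ s → 2 ℕ.^ m ≡ 4 ℕ.+ 2 ℕ.* s
2^m≡4+2s (suc (suc k)) (s≤s (s≤s z≤n)) = 2 ℕ.* (2 ℕ.^ k ℕ.∸ 1) , (begin
    2 ℕ.* (2 ℕ.* 2 ℕ.^ k)                  ≡⟨ cong (λ x → 2 ℕ.* (2 ℕ.* x)) (sym (ℕP.m+[n∸m]≡n (ℕP.m^n>0 2 k))) ⟩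
    2 ℕ.* (2 ℕ.* (1 ℕ.+ (2 ℕ.^ k ℕ.∸ 1)))   ≡⟨ ℕS.solve 1 (λ p → con 2 :* (con 2 :* (con 1 :+ p)) := con 4 :+ con 2 :* (con 2 :* p)) refl _ ⟩
    4 ℕ.+ 2 ℕ.* (2 ℕ.* (2 ℕ.^ k ℕ.∸ 1))     ∎)
  where
  open ℕ-Solver.+-*-Solver using (_:+_; _:*_; _:=_; con)
  module ℕS = ℕ-Solver.+-*-Solver

theorem3p3 :
  ∀ (m : ℕ) → 2 ≤ m → (𝔽 : GF2^ (2 ℕ.* m)) →
  let open GF2^ 𝔽
      n = 2 ℕ.* m
      q = 2 ℕ.^ m
  in (ω : F) → IsPrimitive ω →
  let u = ω ^ ((q ℕ.∸ 1) ℕ.* (2 ℕ.^ (n ℕ.∸ 1) ℕ.∸ 1))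
  in (a₁ a₂ : F) → a₂ ≢ 0# →
     (l₁ l₂ : ℕ) → gcd l₂ (q ℕ.+ 1) ≡ 1 →
     (I : Subset q) →
  let -- x ∈ N = ⋃_{i ∈ I} u^i F_q^*
      InN : F → Set
      InN = λ x → Σ (Fin q) λ i → i ∈ I ×
                    Σ F λ y → (y ^ q ≡ y) × (y ≢ 0#) × (x ≡ u ^ toℕ i * y)
      -- x^(q-1) = u^(2i) for some i ∈ I
      InD : F → Set
      InD = λ x → Σ (Fin q) λ i → i ∈ I × (x ^ (q ℕ.∸ 1) ≡ u ^ (2 ℕ.* toℕ i))
  in (f : F → Bool) →
     (∀ x → InN x → f x ≡ Tr (a₁ * x ^ (l₁ ℕ.* (q ℕ.∸ 1)))) →
     (∀ x → ¬ InN x → f x ≡ Tr (a₂ * x ^ (l₂ ℕ.* (q ℕ.∸ 1)))) →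
     (IsBent 𝔽 m f ⇔
        (sumSubset I (λ i → sgn (Tr (a₁ * (u ⁻¹) ^ (2 ℕ.* toℕ i ℕ.* l₁)))
                       ℤ.- sgn (Tr (a₂ * (u ⁻¹) ^ (2 ℕ.* toℕ i ℕ.* l₂))))
          ≡ kloosterman 𝔽 m (a₂ ^ (q ℕ.+ 1))))
     ×
     ((g : F → Bool) →
      (∀ x → InD x → g x ≡ Tr (a₁ * x ^ (l₁ ℕ.* (q ℕ.* q ℕ.∸ q)))) →
      (∀ x → ¬ InD x → g x ≡ Tr (a₂ * x ^ (l₂ ℕ.* (q ℕ.* q ℕ.∸ q)))) →
      IsBent 𝔽 m f → IsDualOf 𝔽 m g f)
theorem3p3 m 2≤m 𝔽 ω ω-primitive a₁ a₂ a₂≢0 l₁ l₂ l₂⊥q+1 I f f-N f-¬N with 2^m≡4+2s m 2≤m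
... | s , q≡4+2s =
  bent⇔ΣI≡Kl (f≗fφ f f-N f-¬N) , λ g g-D g-¬D → dual (f≗fφ f f-N f-¬N) (g≗fφ∘⁻¹ g g-D g-¬D)
  where open BentCriterion m s q≡4+2s 𝔽 ω ω-primitive a₁ a₂ a₂≢0 l₁ l₂ l₂⊥q+1 I
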